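{- For all integers $m,n\ge 2$, the number $T^{\mathsf{NW}}_{m,n}$ of spotlight tilings of an $m\times n$ rectangle with its northwest corner square removed satisfies $$T^{\mathsf{NW}}_{m,n}=T_{m-1,n-1}+T_{1,n-1}T_{m-2,n}+T_{m-1,1}T_{m,n-2}=T_{m-1,n-1}+(n-1)T_{m-2,n}+(m-1)T_{m,n-2}$$ $$=\binom{m+n-2}{m-1}\left[1+(m-1)(n-1)\left(\frac1m+\frac1n-\frac1{m+n-2}\right)\right].$$
   Context: A region is a finite set of unit squares of the square grid whose edge-adjacency graph is connected. A northwest corner of a region $R$ is a square of $R$ such that neither the square directly above it nor the square directly to its left belongs to $R$. A spotlight tiling of $R$ is produced recursively: choose a northwest corner $s$ of $R$ and place a spotlight with endpoint $s$, extending either east or south as far as possible, i.e. consisting of $s$ together with the maximal run of consecutive squares of $R$ in that direction. The uncovered squares form a disjoint union of regions (connected components), each of which is then given a spotlight tiling recursively; the empty region has exactly one (empty) tiling. The spotlight tiling is the final collection of spotlights; two spotlight tilings are the same if and only if they give the same collection of spotlights. $T_{p,q}$ denotes the number of spotlight tilings of a $p\times q$ rectangle ($p$ rows, $q$ columns) for $p,q\ge1$, with the convention $T_{p,0}=T_{0,q}=1$. -}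

module Defs where

open import Level using (Level; Lift; 0ℓ) renaming (suc to lsuc)
open import Data.Nat using (ℕ; zero; suc; _+_; _*_; _∸_; _≤_; _<_; s≤s; z≤n)
open import Data.Nat.Properties using (≤-trans; m≤n+m)
open import Data.Nat.Combinatorics using (_C_)
open import Data.Fin using (Fin)
open import Data.Product using (Σ; ∃; _×_; _,_; proj₁; proj₂)
open import Data.Sum using (_⊎_)
open import Relation.Nullary using (¬_)
open import Relation.Binary.PropositionalEquality using (_≡_; _≢_)
open import Data.Integer using (+_)
import Data.Nat as ℕ
open import Data.Rational using (ℚ; _/_; 1ℚ)
  renaming (_+_ to _+ℚ_; _-_ to _-ℚ_; _*_ to _*ℚ_)

-- A square is (row , column); rows increase
-- downwards (south), columns increase rightwards (east).
-- All regions considered live in the quadrant ℕ × ℕ (rectangles are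
-- placed with their northwest square at (0 , 0)).

Square : Set
Square = ℕ × ℕ

row col : Square → ℕ
row = proj₁
col = proj₂

Region : Set₁
Region = Square → Set

data Adj : Square → Square → Set where
  east  : ∀ i j → Adj (i , j) (i , suc j)
  west  : ∀ i j → Adj (i , suc j) (i , j)
  south : ∀ i j → Adj (i , j) (suc i , j)
  north : ∀ i j → Adj (suc i , j) (i , j)

data Reach (U : Region) : Square → Square → Set where
  here : ∀ {a} → U a → Reach U a a
  step : ∀ {a b c} → Reach U a b → Adj b c → U c → Reach U a c

Comp : Region → Square → Region
Comp U a b = Reach U a b

NWCorner : Region → Square → Set
NWCorner R (i , j) =
  R (i , j) × (∀ i' → i ≡ suc i' → ¬ R (i' , j))
            × (∀ j' → j ≡ suc j' → ¬ R (i , j'))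

data Dir : Set where
  East South : Dir

move : Square → Dir → ℕ → Square
move (i , j) East  k = (i , j + k)
move (i , j) South k = (i + k , j)

MaxRun : Region → Square → Dir → ℕ → Set
MaxRun R s d ℓ = (∀ k → k ≤ ℓ → R (move s d k)) × ¬ R (move s d (suc ℓ))

-- A spotlight is recorded by its two end squares (its northwest end and
-- its other end); it consists of the squares between them.  (A single
-- square has the same encoding whichever direction it was placed in.)
Spot : Set
Spot = Square × Square

spot : Square → Dir → ℕ → Spot
spot s d ℓ = (s , move s d ℓ)

InSpot : Spot → Square → Set
InSpot ((i₁ , j₁) , (i₂ , j₂)) (i , j) = (i₁ ≤ i × i ≤ i₂) × (j₁ ≤ j × j ≤ j₂)

_∖_ : Region → Spot → Region
(R ∖ L) t = R t × ¬ InSpot L t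

SpotSet : Set₁
SpotSet = Spot → Set

_≐_ : SpotSet → SpotSet → Set
S ≐ S' = ∀ x → (S x → S' x) × (S' x → S x)

-- Choose a northwest corner s, a direction d, place the
-- spotlight L = maximal run from s in direction d; the remaining squares
-- R ∖ L split into connected components; f assigns to every remaining
-- square a tiling of its component (the same tiling, up to ≐, for squares
-- in the same component); S is L together with all these tilings.
data Tiled : Region → SpotSet → Set₁ where
  tile : ∀ {R S} (s : Square) → NWCorner R s → (d : Dir) → (ℓ : ℕ) →
         MaxRun R s d ℓ →
         (f : (a : Square) → (R ∖ spot s d ℓ) a → SpotSet) →
         (∀ a b (p : (R ∖ spot s d ℓ) a) (q : (R ∖ spot s d ℓ) b) →
            Reach (R ∖ spot s d ℓ) a b → f a p ≐ f b q) →
         (∀ a (p : (R ∖ spot s d ℓ) a) →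
            Tiled (Comp (R ∖ spot s d ℓ) a) (f a p)) →
         (∀ x → (S x → (x ≡ spot s d ℓ ⊎ Σ Square λ a → Σ ((R ∖ spot s d ℓ) a) λ p → f a p x))
              × ((x ≡ spot s d ℓ ⊎ Σ Square λ a → Σ ((R ∖ spot s d ℓ) a) λ p → f a p x) → S x)) →
         Tiled R S

NumTilings : Region → ℕ → Set₁
NumTilings R N =
  Σ (Fin N → SpotSet) λ v →
    (∀ i → Tiled R (v i)) ×
    (∀ i j → v i ≐ v j → i ≡ j) ×
    (∀ S → Tiled R S → ∃ λ i → S ≐ v i)

Rect : ℕ → ℕ → Region
Rect p q (i , j) = i < p × j < q

RectNW : ℕ → ℕ → Region
RectNW m n t = Rect m n t × t ≢ (0 , 0)

-- TCount p q N : T_{p,q} = N, with the convention T_{p,0} = T_{0,q} = 1.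
TCount : ℕ → ℕ → ℕ → Set₁
TCount zero    q       N = Lift (lsuc 0ℓ) (N ≡ 1)
TCount (suc p) zero    N = Lift (lsuc 0ℓ) (N ≡ 1)
TCount (suc p) (suc q) N = NumTilings (Rect (suc p) (suc q)) N

ℕtoℚ : ℕ → ℚ
ℕtoℚ k = + k / 1

recip : (k : ℕ) → 0 < k → ℚ
recip k p = _/_ (+ 1) k {{ℕ.>-nonZero p}}

private
  pos : ∀ {k} → 2 ≤ k → 0 < k
  pos (s≤s _) = s≤s z≤n

  pos₂ : ∀ m n → 2 ≤ m → 2 ≤ n → 0 < m + n ∸ 2
  pos₂ (suc (suc m)) (suc (suc n)) (s≤s (s≤s _)) (s≤s (s≤s _)) = ≤-trans (s≤s z≤n) (m≤n+m (suc (suc n)) m)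

closedForm : (m n : ℕ) → 2 ≤ m → 2 ≤ n → ℚ
closedForm m n hm hn =
  ℕtoℚ ((m + n ∸ 2) C (m ∸ 1)) *ℚ
    (1ℚ +ℚ ℕtoℚ ((m ∸ 1) * (n ∸ 1)) *ℚ
       (recip m (pos hm) +ℚ recip n (pos hn) -ℚ recip (m + n ∸ 2) (pos₂ m n hm hn)))

module Submission where

open import Defs
open import Level using (lift; 0ℓ)
open import Data.Empty using (⊥; ⊥-elim)
open import Data.Product using (Σ; ∃; _×_; _,_; proj₁; proj₂)
open import Data.Sum using (_⊎_; inj₁; inj₂)
import Data.Sum as Sum
open import Data.List using (_∷_; [])
open import Data.Fin using (Fin) renaming (zero to fzero)
open import Data.Fin.Properties using (+↔⊎; *↔×; injective⇒≤)
open import Function.Bundles using (_↔_; Inverse)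
open import Function.Properties.Inverse using (↔-refl; ↔-trans)
open import Data.Sum.Function.Propositional using (_⊎-↔_)
open import Relation.Nullary using (¬_)
open import Relation.Nullary.Decidable using (dec⇒maybe)
open import Relation.Binary.PropositionalEquality
open import Relation.Binary.Definitions using (tri<; tri≈; tri>)
open import Data.Nat using (ℕ; zero; suc; _+_; _*_; _∸_; _≤_; _<_; s≤s; z≤n; z<s)
open import Data.Nat.Properties
open import Data.Nat.Combinatorics using (_C_; nCn≡1; nCk+nC[k+1]≡[n+1]C[k+1])
open import Data.Nat.Tactic.RingSolver using (solve)
open import Algebra.Properties.CommutativeSemigroup +-commutativeSemigroup using () renaming (interchange to +-interchange)
open import Data.Integer using () renaming (+_ to pos)
import Data.Integer as ℤ
import Data.Integer.Properties as ℤP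
open import Data.Rational using (ℚ; 1ℚ; 0ℚ; toℚᵘ) renaming (_+_ to _+ℚ_; _*_ to _*ℚ_; _-_ to _-ℚ_)
import Data.Rational.Properties as ℚP
open import Data.Rational.Unnormalised using (ℚᵘ; mkℚᵘ; *≡*) renaming (_+_ to _+ᵘ_; _*_ to _*ᵘ_; _≃_ to _≃ᵘ_)
import Data.Rational.Unnormalised.Properties as ℚᵘP
open ℚᵘP using (≃-trans; ≃-sym)
import Tactic.RingSolver as RingSolver
import Tactic.RingSolver.Core.AlmostCommutativeRing as ACR

_≅_ : Region → Region → Set
R ≅ R' = ∀ t → (R t → R' t) × (R' t → R t)

≅-sym : ∀ {R R'} → R ≅ R' → R' ≅ R
≅-sym e t = proj₂ (e t) , proj₁ (e t)

adj-sym : ∀ {a b} → Adj a b → Adj b a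
adj-sym (east i j)  = west i j
adj-sym (west i j)  = east i j
adj-sym (south i j) = north i j
adj-sym (north i j) = south i j

module _ {U : Region} where
  reach-tgt : ∀ {a b} → Reach U a b → U b
  reach-tgt (here x)     = x
  reach-tgt (step _ _ u) = u

  reach-trans : ∀ {a b c} → Reach U a b → Reach U b c → Reach U a c
  reach-trans r (here _)      = r
  reach-trans r (step r' x u) = step (reach-trans r r') x u

  reach-sym : ∀ {a b} → Reach U a b → Reach U b a
  reach-sym (here x)     = here x
  reach-sym (step r x u) = reach-trans (step (here u) (adj-sym x) (reach-tgt r)) (reach-sym r)

  reach-preserves : (P : Square → Set) → (∀ {x y} → U x → U y → Adj x y → P x → P y) →
                    ∀ {a b} → Reach U a b → P a → P b
  reach-preserves P cl (here x)     pa = pa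
  reach-preserves P cl (step r x u) pa = cl (reach-tgt r) u x (reach-preserves P cl r pa)

reach-mono : ∀ {U V : Region} → (∀ t → U t → V t) → ∀ {a b} → Reach U a b → Reach V a b
reach-mono h (here x)     = here (h _ x)
reach-mono h (step r x u) = step (reach-mono h r) x (h _ u)

∅S : SpotSet
∅S _ = ⊥

⟦_⟧ : Spot → SpotSet
⟦ L ⟧ x = x ≡ L

infixr 5 _∪S_
_∪S_ : SpotSet → SpotSet → SpotSet
(A ∪S B) x = A x ⊎ B x

≐-refl : ∀ {A} → A ≐ A
≐-refl x = (λ a → a) , (λ a → a)

≐-sym : ∀ {A B} → A ≐ B → B ≐ A
≐-sym e x = proj₂ (e x) , proj₁ (e x)

≐-trans : ∀ {A B C} → A ≐ B → B ≐ C → A ≐ C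
≐-trans e f x = (λ a → proj₁ (f x) (proj₁ (e x) a)) , (λ c → proj₂ (e x) (proj₂ (f x) c))

∪-cong : ∀ {A B C D} → A ≐ C → B ≐ D → (A ∪S B) ≐ (C ∪S D)
∪-cong e f x = Sum.map (proj₁ (e x)) (proj₁ (f x)) , Sum.map (proj₂ (e x)) (proj₂ (f x))

-- Tilings of a possibly empty region: the empty region has exactly the empty
-- tiling.  Blocks left over by a spotlight may be empty, so counts are taken
-- in this sense.
Tiled∅ : Region → SpotSet → Set₁
Tiled∅ B S = Tiled B S ⊎ ((∀ a → ¬ B a) × (S ≐ ∅S))

transport : ∀ {R R' S S'} → R ≅ R' → S ≐ S' → Tiled R S → Tiled R' S'
transport {R} {R'} {S} {S'} e e' (tile s (r , n1 , n2) d ℓ (m1 , m2) f fcons fc spec) =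
  tile s (proj₁ (e s) r , (λ i' eq x → n1 i' eq (proj₂ (e _) x)) , (λ j' eq x → n2 j' eq (proj₂ (e _) x)))
       d ℓ ((λ k k≤ → proj₁ (e _) (m1 k k≤)) , (λ x → m2 (proj₂ (e _) x)))
       f' fcons' fc' spec'
  where
    L = spot s d ℓ
    back : ∀ {a} → (R' ∖ L) a → (R ∖ L) a
    back (x , y) = proj₂ (e _) x , y
    forth : ∀ {a} → (R ∖ L) a → (R' ∖ L) a
    forth (x , y) = proj₁ (e _) x , y
    f' : (a : Square) → (R' ∖ L) a → SpotSet
    f' a p = f a (back p)
    fcons' : ∀ a b (p : (R' ∖ L) a) (q : (R' ∖ L) b) → Reach (R' ∖ L) a b → f' a p ≐ f' b q
    fcons' a b p q r = fcons a b (back p) (back q) (reach-mono (λ t → back) r)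
    fc' : ∀ a (p : (R' ∖ L) a) → Tiled (Comp (R' ∖ L) a) (f' a p)
    fc' a p = transport (λ t → reach-mono (λ t → forth) , reach-mono (λ t → back)) ≐-refl (fc a (back p))
    spec' : ∀ x → (S' x → (x ≡ L ⊎ Σ Square λ a → Σ ((R' ∖ L) a) λ p → f' a p x))
               × ((x ≡ L ⊎ Σ Square λ a → Σ ((R' ∖ L) a) λ p → f' a p x) → S' x)
    spec' x = fw , bw
      where
        fw : S' x → (x ≡ L ⊎ Σ Square λ a → Σ ((R' ∖ L) a) λ p → f' a p x)
        fw sx with proj₁ (spec x) (proj₂ (e' x) sx)
        ... | inj₁ eq = inj₁ eq
        ... | inj₂ (a , p , fx) = inj₂ (a , forth p , proj₁ (fcons a a p (back (forth p)) (here p) x) fx)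
        bw : (x ≡ L ⊎ Σ Square λ a → Σ ((R' ∖ L) a) λ p → f' a p x) → S' x
        bw (inj₁ eq)           = proj₁ (e' x) (proj₂ (spec x) (inj₁ eq))
        bw (inj₂ (a , p , fx)) = proj₁ (e' x) (proj₂ (spec x) (inj₂ (a , back p , fx)))

tiled-ends : ∀ {R S} → Tiled R S → ∀ x → S x → R (proj₁ x) × R (proj₂ x)
tiled-ends (tile s (r , _) d ℓ (m1 , _) f fcons fc spec) x sx with proj₁ (spec x) sx
... | inj₁ refl = r , m1 ℓ ≤-refl
... | inj₂ (a , p , fx) with tiled-ends (fc a p) x fx
... | c1 , c2 = proj₁ (reach-tgt c1) , proj₁ (reach-tgt c2)

tiled∅-ends : ∀ {R S} → Tiled∅ R S → ∀ x → S x → R (proj₁ x) × R (proj₂ x)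
tiled∅-ends (inj₁ t)       = tiled-ends t
tiled∅-ends (inj₂ (_ , e)) x sx = ⊥-elim (proj₁ (e x) sx)

start∈ : ∀ {B S} → Tiled∅ B S → ∀ x → S x → B (proj₁ x)
start∈ t x sx = proj₁ (tiled∅-ends t x sx)

tiled∅-empty : ∀ {R S} → (∀ a → ¬ R a) → Tiled∅ R S → S ≐ ∅S
tiled∅-empty em (inj₁ (tile s (r , _) _ _ _ _ _ _ _)) = ⊥-elim (em s r)
tiled∅-empty em (inj₂ (_ , e))                         = e

tiled∅⇒tiled : ∀ {B S} → Σ Square B → Tiled∅ B S → Tiled B S
tiled∅⇒tiled _       (inj₁ t)         = t
tiled∅⇒tiled (a , h) (inj₂ (em , _)) = ⊥-elim (em a h)

maxrun-unique : ∀ {R s d ℓ ℓ₀} → (∀ k → k ≤ ℓ₀ → R (move s d k)) → ¬ R (move s d (suc ℓ₀)) →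
                MaxRun R s d ℓ → ℓ ≡ ℓ₀
maxrun-unique {ℓ = ℓ} {ℓ₀} h1 h2 (m1 , m2) with <-cmp ℓ ℓ₀
... | tri≈ _ eq _ = eq
... | tri< lt _ _ = ⊥-elim (m2 (h1 (suc ℓ) lt))
... | tri> _ _ gt = ⊥-elim (h2 (m1 (suc ℓ₀) gt))

-- Hence B₁ and B₂ are exactly the components of U.
record Split (U B₁ B₂ : Region) : Set where
  field
    split : ∀ a → U a → B₁ a ⊎ B₂ a
    inc₁  : ∀ a → B₁ a → U a
    inc₂  : ∀ a → B₂ a → U a
    conn₁ : ∀ a b → B₁ a → B₁ b → Reach B₁ a b
    conn₂ : ∀ a b → B₂ a → B₂ b → Reach B₂ a b
    clos₁ : ∀ {x y} → U x → U y → Adj x y → B₁ x → B₁ y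
    disj  : ∀ a → B₁ a → B₂ a → ⊥

  clos₂ : ∀ {x y} → U x → U y → Adj x y → B₂ x → B₂ y
  clos₂ {x} {y} ux uy ad b2 with split y uy
  ... | inj₁ b1  = ⊥-elim (disj x (clos₁ uy ux (adj-sym ad) b1) b2)
  ... | inj₂ b2' = b2'

  comp₁ : ∀ {a} → B₁ a → Comp U a ≅ B₁
  comp₁ {a} h t = (λ r → reach-preserves B₁ clos₁ r h) , (λ b → reach-mono inc₁ (conn₁ a t h b))

  comp₂ : ∀ {a} → B₂ a → Comp U a ≅ B₂
  comp₂ {a} h t = (λ r → reach-preserves B₂ clos₂ r h) , (λ b → reach-mono inc₂ (conn₂ a t h b))

∅R : Region
∅R _ = ⊥

split-one : ∀ {U B : Region} → (∀ a → U a → B a) → (∀ a → B a → U a) →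
            (∀ a b → B a → B b → Reach B a b) → Split U B ∅R
split-one s i c = record
  { split = λ a u → inj₁ (s a u) ; inc₁ = i ; inc₂ = λ { a () } ; conn₁ = c ; conn₂ = λ { a b () _ }
  ; clos₁ = λ {x} {y} ux uy ad b → s y uy ; disj = λ { a b () } }

Inhabited? : Region → Set
Inhabited? B = Σ Square B ⊎ (∀ a → ¬ B a)

module FirstSpot {R : Region} {s : Square} {d : Dir} {ℓ : ℕ} {B₁ B₂ : Region}
                 (sp : Split (R ∖ spot s d ℓ) B₁ B₂) where
  open Split sp
  private
    L = spot s d ℓ
    U = R ∖ L

  Assembled : SpotSet → (f : (a : Square) → U a → SpotSet) → Set
  Assembled S f = ∀ x → (S x → (x ≡ L ⊎ Σ Square λ a → Σ (U a) λ p → f a p x))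
                      × ((x ≡ L ⊎ Σ Square λ a → Σ (U a) λ p → f a p x) → S x)

  build : ∀ {S₁ S₂} → NWCorner R s → MaxRun R s d ℓ → Tiled∅ B₁ S₁ → Tiled∅ B₂ S₂ →
          Tiled R (⟦ L ⟧ ∪S (S₁ ∪S S₂))
  build {S₁} {S₂} nw mr t₁ t₂ = tile s nw d ℓ mr f fcons fc spec
    where
      choose : ∀ {a} → B₁ a ⊎ B₂ a → SpotSet
      choose (inj₁ _) = S₁
      choose (inj₂ _) = S₂
      f : (a : Square) → U a → SpotSet
      f a p = choose (split a p)
      cons' : ∀ {a b} (w : B₁ a ⊎ B₂ a) (w' : B₁ b ⊎ B₂ b) → Reach U a b → choose w ≐ choose w'
      cons' (inj₁ _) (inj₁ _) r = ≐-refl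
      cons' (inj₂ _) (inj₂ _) r = ≐-refl
      cons' {a} {b} (inj₁ h) (inj₂ h') r = ⊥-elim (disj b (proj₁ (comp₁ h b) r) h')
      cons' {a} {b} (inj₂ h) (inj₁ h') r = ⊥-elim (disj a (proj₁ (comp₁ h' a) (reach-sym r)) h)
      fcons : ∀ a b (p : U a) (q : U b) → Reach U a b → f a p ≐ f b q
      fcons a b p q r = cons' (split a p) (split b q) r
      onComp : ∀ {a B S} → Comp U a ≅ B → B a → Tiled∅ B S → Tiled (Comp U a) S
      onComp ce h t = transport (≅-sym ce) ≐-refl (tiled∅⇒tiled (_ , h) t)
      fc' : ∀ {a} (w : B₁ a ⊎ B₂ a) → Tiled (Comp U a) (choose w)
      fc' (inj₁ h) = onComp (comp₁ h) h t₁
      fc' (inj₂ h) = onComp (comp₂ h) h t₂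
      fc : ∀ a (p : U a) → Tiled (Comp U a) (f a p)
      fc a p = fc' (split a p)
      pick₁ : ∀ {a} x → B₁ a → (w : B₁ a ⊎ B₂ a) → S₁ x → choose w x
      pick₁ x h (inj₁ _) sx = sx
      pick₁ {a} x h (inj₂ h') sx = ⊥-elim (disj a h h')
      pick₂ : ∀ {a} x → B₂ a → (w : B₁ a ⊎ B₂ a) → S₂ x → choose w x
      pick₂ {a} x h (inj₁ h') sx = ⊥-elim (disj a h' h)
      pick₂ x h (inj₂ _) sx = sx
      unpick : ∀ {a} x (w : B₁ a ⊎ B₂ a) → choose w x → (S₁ ∪S S₂) x
      unpick x (inj₁ _) c = inj₁ c
      unpick x (inj₂ _) c = inj₂ c
      spec : Assembled (⟦ L ⟧ ∪S (S₁ ∪S S₂)) f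
      spec x = fw , bw
        where
          fw : (⟦ L ⟧ ∪S (S₁ ∪S S₂)) x → (x ≡ L ⊎ Σ Square λ a → Σ (U a) λ p → f a p x)
          fw (inj₁ eq) = inj₁ eq
          fw (inj₂ (inj₁ sx)) = let h = start∈ t₁ x sx in
            inj₂ (proj₁ x , inc₁ _ h , pick₁ x h (split _ (inc₁ _ h)) sx)
          fw (inj₂ (inj₂ sx)) = let h = start∈ t₂ x sx in
            inj₂ (proj₁ x , inc₂ _ h , pick₂ x h (split _ (inc₂ _ h)) sx)
          bw : (x ≡ L ⊎ Σ Square λ a → Σ (U a) λ p → f a p x) → (⟦ L ⟧ ∪S (S₁ ∪S S₂)) x
          bw (inj₁ eq) = inj₁ eq
          bw (inj₂ (a , p , c)) = inj₂ (unpick x (split a p) c)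

  module Decompose (f : (a : Square) → U a → SpotSet)
                   (fcons : ∀ a b (p : U a) (q : U b) → Reach U a b → f a p ≐ f b q)
                   (fc : ∀ a (p : U a) → Tiled (Comp U a) (f a p)) where
    part₁ : Inhabited? B₁ → SpotSet
    part₁ (inj₁ (a , h)) = f a (inc₁ a h)
    part₁ (inj₂ _)       = ∅S
    part₂ : Inhabited? B₂ → SpotSet
    part₂ (inj₁ (a , h)) = f a (inc₂ a h)
    part₂ (inj₂ _)       = ∅S
    part₁-tiles : (i : Inhabited? B₁) → Tiled∅ B₁ (part₁ i)
    part₁-tiles (inj₁ (a , h)) = inj₁ (transport (comp₁ h) ≐-refl (fc a (inc₁ a h)))
    part₁-tiles (inj₂ em)      = inj₂ (em , ≐-refl)
    part₂-tiles : (i : Inhabited? B₂) → Tiled∅ B₂ (part₂ i)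
    part₂-tiles (inj₁ (a , h)) = inj₁ (transport (comp₂ h) ≐-refl (fc a (inc₂ a h)))
    part₂-tiles (inj₂ em)      = inj₂ (em , ≐-refl)
    into₁ : ∀ x a (p : U a) → B₁ a → f a p x → (i : Inhabited? B₁) → part₁ i x
    into₁ x a p h fx (inj₁ (a₁ , h₁)) = proj₁ (fcons a a₁ p (inc₁ a₁ h₁) (reach-mono inc₁ (conn₁ a a₁ h h₁)) x) fx
    into₁ x a p h fx (inj₂ em) = ⊥-elim (em a h)
    into₂ : ∀ x a (p : U a) → B₂ a → f a p x → (i : Inhabited? B₂) → part₂ i x
    into₂ x a p h fx (inj₁ (a₂ , h₂)) = proj₁ (fcons a a₂ p (inc₂ a₂ h₂) (reach-mono inc₂ (conn₂ a a₂ h h₂)) x) fx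
    into₂ x a p h fx (inj₂ em) = ⊥-elim (em a h)
    outof₁ : ∀ x (i : Inhabited? B₁) → part₁ i x → Σ Square λ a → Σ (U a) λ p → f a p x
    outof₁ x (inj₁ (a , h)) c = a , inc₁ a h , c
    outof₂ : ∀ x (i : Inhabited? B₂) → part₂ i x → Σ Square λ a → Σ (U a) λ p → f a p x
    outof₂ x (inj₁ (a , h)) c = a , inc₂ a h , c
    into : ∀ x a (p : U a) → f a p x → (w : B₁ a ⊎ B₂ a) → (i₁ : Inhabited? B₁) → (i₂ : Inhabited? B₂) →
           (part₁ i₁ ∪S part₂ i₂) x
    into x a p fx (inj₁ h) i₁ i₂ = inj₁ (into₁ x a p h fx i₁)
    into x a p fx (inj₂ h) i₁ i₂ = inj₂ (into₂ x a p h fx i₂)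

    decompose : ∀ {S} → Assembled S f → (i₁ : Inhabited? B₁) → (i₂ : Inhabited? B₂) →
                Tiled∅ B₁ (part₁ i₁) × Tiled∅ B₂ (part₂ i₂) × (S ≐ (⟦ L ⟧ ∪S (part₁ i₁ ∪S part₂ i₂)))
    decompose {S} spec i₁ i₂ = part₁-tiles i₁ , part₂-tiles i₂ , λ x → fw x , bw x
      where
        fw : ∀ x → S x → (⟦ L ⟧ ∪S (part₁ i₁ ∪S part₂ i₂)) x
        fw x sx with proj₁ (spec x) sx
        ... | inj₁ eq = inj₁ eq
        ... | inj₂ (a , p , fx) = inj₂ (into x a p fx (split a p) i₁ i₂)
        bw : ∀ x → (⟦ L ⟧ ∪S (part₁ i₁ ∪S part₂ i₂)) x → S x
        bw x (inj₁ eq)         = proj₂ (spec x) (inj₁ eq)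
        bw x (inj₂ (inj₁ c))   = proj₂ (spec x) (inj₂ (outof₁ x i₁ c))
        bw x (inj₂ (inj₂ c))   = proj₂ (spec x) (inj₂ (outof₂ x i₂ c))

  decompose-by-split : ∀ {S} (f : (a : Square) → U a → SpotSet) →
    (∀ a b (p : U a) (q : U b) → Reach U a b → f a p ≐ f b q) →
    (∀ a (p : U a) → Tiled (Comp U a) (f a p)) → Assembled S f →
    Inhabited? B₁ → Inhabited? B₂ →
    Σ SpotSet λ S₁ → Σ SpotSet λ S₂ → Tiled∅ B₁ S₁ × Tiled∅ B₂ S₂ × (S ≐ (⟦ L ⟧ ∪S (S₁ ∪S S₂)))
  decompose-by-split f fcons fc spec i₁ i₂ = _ , _ , Decompose.decompose f fcons fc spec i₁ i₂

Box : ℕ → ℕ → ℕ → ℕ → Region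
Box r c p q (i , j) = (r ≤ i × i < r + p) × (c ≤ j × j < c + q)

rect≅box : ∀ p q → Rect p q ≅ Box 0 0 p q
rect≅box p q (i , j) = (λ { (a , b) → (z≤n , a) , (z≤n , b) }) , (λ { ((_ , a) , (_ , b)) → a , b })

row-path : ∀ {U : Region} i j d → (∀ k → k ≤ d → U (i , j + k)) → Reach U (i , j) (i , j + d)
row-path {U} i j zero h =
  subst (λ z → Reach U (i , j) (i , z)) (sym (+-identityʳ j)) (here (subst (λ z → U (i , z)) (+-identityʳ j) (h 0 z≤n)))
row-path {U} i j (suc d) h = subst (λ z → Reach U (i , j) (i , z)) (sym (+-suc j d))
  (step (row-path i j d (λ k k≤ → h k (m≤n⇒m≤1+n k≤))) (east i (j + d)) (subst (λ z → U (i , z)) (+-suc j d) (h (suc d) ≤-refl)))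

col-path : ∀ {U : Region} i j d → (∀ k → k ≤ d → U (i + k , j)) → Reach U (i , j) (i + d , j)
col-path {U} i j zero h =
  subst (λ z → Reach U (i , j) (z , j)) (sym (+-identityʳ i)) (here (subst (λ z → U (z , j)) (+-identityʳ i) (h 0 z≤n)))
col-path {U} i j (suc d) h = subst (λ z → Reach U (i , j) (z , j)) (sym (+-suc i d))
  (step (col-path i j d (λ k k≤ → h k (m≤n⇒m≤1+n k≤))) (south (i + d) j) (subst (λ z → U (z , j)) (+-suc i d) (h (suc d) ≤-refl)))

between : ∀ {x y k} → x ≤ y → k ≤ y ∸ x → x ≤ x + k × x + k ≤ y
between {x} {y} {k} x≤y k≤ = m≤m+n x k , subst (x + k ≤_) (m+[n∸m]≡n x≤y) (+-monoʳ-≤ x k≤)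

row-reach : ∀ {U : Region} i {j j'} → (∀ k → j ≤ k → k ≤ j' → U (i , k)) → j ≤ j' → Reach U (i , j) (i , j')
row-reach {U} i {j} {j'} h le = subst (λ z → Reach U (i , j) (i , z)) (m+[n∸m]≡n le)
  (row-path i j (j' ∸ j) (λ k k≤ → let (a , b) = between le k≤ in h (j + k) a b))

col-reach : ∀ {U : Region} {i i'} j → (∀ k → i ≤ k → k ≤ i' → U (k , j)) → i ≤ i' → Reach U (i , j) (i' , j)
col-reach {U} {i} {i'} j h le = subst (λ z → Reach U (i , j) (z , j)) (m+[n∸m]≡n le)
  (col-path i j (i' ∸ i) (λ k k≤ → let (a , b) = between le k≤ in h (i + k) a b))

row-reach' : ∀ {U : Region} i {j j'} → (∀ k → j ≤ k → k ≤ j' → U (i , k)) → (∀ k → j' ≤ k → k ≤ j → U (i , k)) →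
             Reach U (i , j) (i , j')
row-reach' i {j} {j'} h h' with ≤-total j j'
... | inj₁ le = row-reach i h le
... | inj₂ le = reach-sym (row-reach i h' le)

col-reach' : ∀ {U : Region} {i i'} j → (∀ k → i ≤ k → k ≤ i' → U (k , j)) → (∀ k → i' ≤ k → k ≤ i → U (k , j)) →
             Reach U (i , j) (i' , j)
col-reach' {i = i} {i'} j h h' with ≤-total i i'
... | inj₁ le = col-reach j h le
... | inj₂ le = reach-sym (col-reach j h' le)

-- A box is connected: go along the row, then along the column.
box-conn : ∀ r c p q a b → Box r c p q a → Box r c p q b → Reach (Box r c p q) a b
box-conn r c p q (i , j) (i' , j') ((a1 , a2) , (a3 , a4)) ((b1 , b2) , (b3 , b4)) =
  reach-trans (row-reach' i (λ k x y → (a1 , a2) , (≤-trans a3 x , ≤-<-trans y b4))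
                            (λ k x y → (a1 , a2) , (≤-trans b3 x , ≤-<-trans y a4)))
              (col-reach' j' (λ k x y → (≤-trans a1 x , ≤-<-trans y b2) , (b3 , b4))
                             (λ k x y → (≤-trans b1 x , ≤-<-trans y a2) , (b3 , b4)))

least-coord : ∀ {r} i → r ≤ i → (∀ i' → i ≡ suc i' → r ≤ i' → ⊥) → i ≡ r
least-coord zero z≤n h = refl
least-coord (suc i) ri h with m≤n⇒m<n∨m≡n ri
... | inj₂ eq       = sym eq
... | inj₁ (s≤s lt) = ⊥-elim (h i refl lt)

box-nw : ∀ {r c p q i j} → NWCorner (Box r c p q) (i , j) → i ≡ r × j ≡ c
box-nw {r} {c} {p} {q} {i} {j} (((ri , ip) , (cj , jq)) , n1 , n2) =
  least-coord i ri (λ i' eq lt → n1 i' eq ((lt , ≤-trans (n≤1+n _) (subst (λ z → z < r + p) eq ip)) , (cj , jq))) ,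
  least-coord j cj (λ j' eq lt → n2 j' eq ((ri , ip) , (lt , ≤-trans (n≤1+n _) (subst (λ z → z < c + q) eq jq))))

box-nwc : ∀ r c p q → NWCorner (Box r c (suc p) (suc q)) (r , c)
box-nwc r c p q = ((≤-refl , m<m+n r z<s) , (≤-refl , m<m+n c z<s)) ,
  (λ i' eq ((ri , _) , _) → <-irrefl eq (s≤s ri)) , (λ j' eq (_ , (cj , _)) → <-irrefl eq (s≤s cj))

box-empty₁ : ∀ {r c q} a → ¬ Box r c 0 q a
box-empty₁ {r} (i , j) ((ri , ip) , _) = <-irrefl refl (≤-<-trans ri (subst (i <_) (+-identityʳ r) ip))

box-empty₂ : ∀ {r c p} a → ¬ Box r c p 0 a
box-empty₂ {r} {c} (i , j) (_ , (cj , jq)) = <-irrefl refl (≤-<-trans cj (subst (j <_) (+-identityʳ c) jq))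

box-inhabited? : ∀ r c p q → Inhabited? (Box r c p q)
box-inhabited? r c zero q          = inj₂ box-empty₁
box-inhabited? r c (suc p) zero    = inj₂ box-empty₂
box-inhabited? r c (suc p) (suc q) = inj₁ ((r , c) , proj₁ (box-nwc r c p q))

∅R-inhabited? : Inhabited? ∅R
∅R-inhabited? = inj₂ (λ a ())

box-runE : ∀ r c p q → MaxRun (Box r c (suc p) (suc q)) (r , c) East q
box-runE r c p q = (λ k k≤ → (≤-refl , m<m+n r z<s) , (m≤m+n c k , +-monoʳ-< c (s≤s k≤))) ,
                   (λ (_ , (_ , lt)) → <-irrefl refl lt)

box-runS : ∀ r c p q → MaxRun (Box r c (suc p) (suc q)) (r , c) South p
box-runS r c p q = (λ k k≤ → (m≤m+n r k , +-monoʳ-< r (s≤s k≤)) , (≤-refl , m<m+n c z<s)) ,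
                   (λ ((_ , lt) , _) → <-irrefl refl lt)

+suc< : ∀ {i} r p → i < r + suc p → i < suc r + p
+suc< {i} r p lt = subst (i <_) (+-suc r p) lt

+suc<' : ∀ {i} r p → i < suc r + p → i < r + suc p
+suc<' {i} r p lt = subst (i <_) (sym (+-suc r p)) lt

box-splitE : ∀ r c p q → Split (Box r c (suc p) (suc q) ∖ spot (r , c) East q) (Box (suc r) c p (suc q)) ∅R
box-splitE r c p q = split-one below include (box-conn (suc r) c p (suc q))
  where
    below : ∀ a → (Box r c (suc p) (suc q) ∖ spot (r , c) East q) a → Box (suc r) c p (suc q) a
    below (i , j) (((ri , ip) , (cj , jq)) , nin) with m≤n⇒m<n∨m≡n ri
    ... | inj₁ lt   = (lt , +suc< r p ip) , (cj , jq)
    ... | inj₂ refl = ⊥-elim (nin ((≤-refl , ≤-refl) , (cj , ≤-pred (+suc< c q jq))))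
    include : ∀ a → Box (suc r) c p (suc q) a → (Box r c (suc p) (suc q) ∖ spot (r , c) East q) a
    include (i , j) ((sri , ip) , (cj , jq)) = ((≤-trans (n≤1+n r) sri , +suc<' r p ip) , (cj , jq)) ,
      λ { ((_ , i≤r) , _) → <-irrefl refl (<-≤-trans sri i≤r) }

box-splitS : ∀ r c p q → Split (Box r c (suc p) (suc q) ∖ spot (r , c) South p) (Box r (suc c) (suc p) q) ∅R
box-splitS r c p q = split-one right include (box-conn r (suc c) (suc p) q)
  where
    right : ∀ a → (Box r c (suc p) (suc q) ∖ spot (r , c) South p) a → Box r (suc c) (suc p) q a
    right (i , j) (((ri , ip) , (cj , jq)) , nin) with m≤n⇒m<n∨m≡n cj
    ... | inj₁ lt   = (ri , ip) , (lt , +suc< c q jq)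
    ... | inj₂ refl = ⊥-elim (nin ((ri , ≤-pred (+suc< r p ip)) , (≤-refl , ≤-refl)))
    include : ∀ a → Box r (suc c) (suc p) q a → (Box r c (suc p) (suc q) ∖ spot (r , c) South p) a
    include (i , j) ((ri , ip) , (scj , jq)) = ((ri , ip) , (≤-trans (n≤1+n c) scj , +suc<' c q jq)) ,
      λ { (_ , (_ , j≤c)) → <-irrefl refl (<-≤-trans scj j≤c) }

∅-tiled : Tiled∅ ∅R ∅S
∅-tiled = inj₂ ((λ a ()) , ≐-refl)

box-buildE : ∀ {r c p q S₁} → Tiled∅ (Box (suc r) c p (suc q)) S₁ →
  Tiled (Box r c (suc p) (suc q)) (⟦ spot (r , c) East q ⟧ ∪S (S₁ ∪S ∅S))
box-buildE {r} {c} {p} {q} t = FirstSpot.build {s = r , c} {d = East} (box-splitE r c p q) (box-nwc r c p q) (box-runE r c p q) t ∅-tiled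

box-buildS : ∀ {r c p q S₁} → Tiled∅ (Box r (suc c) (suc p) q) S₁ →
  Tiled (Box r c (suc p) (suc q)) (⟦ spot (r , c) South p ⟧ ∪S (S₁ ∪S ∅S))
box-buildS {r} {c} {p} {q} t = FirstSpot.build {s = r , c} {d = South} (box-splitS r c p q) (box-nwc r c p q) (box-runS r c p q) t ∅-tiled

box-decompose : ∀ {r c p q S} → Tiled (Box r c (suc p) (suc q)) S →
  (Σ SpotSet λ S₁ → Tiled∅ (Box (suc r) c p (suc q)) S₁ × (S ≐ (⟦ spot (r , c) East q ⟧ ∪S (S₁ ∪S ∅S))))
  ⊎ (Σ SpotSet λ S₁ → Tiled∅ (Box r (suc c) (suc p) q) S₁ × (S ≐ (⟦ spot (r , c) South p ⟧ ∪S (S₁ ∪S ∅S))))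
box-decompose {r} {c} {p} {q} (tile _ nw d ℓ mr f fcons fc spec) with box-nw nw
... | refl , refl with d
... | East with maxrun-unique {R = Box r c (suc p) (suc q)} {s = r , c} {d = East} (proj₁ (box-runE r c p q)) (proj₂ (box-runE r c p q)) mr
... | refl with FirstSpot.decompose-by-split {s = r , c} {d = East} (box-splitE r c p q) f fcons fc spec
                  (box-inhabited? (suc r) c p (suc q)) ∅R-inhabited?
... | _ , _ , t₁ , t₂ , e = inj₁ (_ , t₁ , ≐-trans e (∪-cong ≐-refl (∪-cong ≐-refl (tiled∅-empty (λ a ()) t₂))))
box-decompose {r} {c} {p} {q} (tile _ nw d ℓ mr f fcons fc spec) | refl , refl | South
  with maxrun-unique {R = Box r c (suc p) (suc q)} {s = r , c} {d = South} (proj₁ (box-runS r c p q)) (proj₂ (box-runS r c p q)) mr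
... | refl with FirstSpot.decompose-by-split {s = r , c} {d = South} (box-splitS r c p q) f fcons fc spec
                  (box-inhabited? r (suc c) (suc p) q) ∅R-inhabited?
... | _ , _ , t₁ , t₂ , e = inj₂ (_ , t₁ , ≐-trans e (∪-cong ≐-refl (∪-cong ≐-refl (tiled∅-empty (λ a ()) t₂))))

record Enum (B : Region) (N : ℕ) : Set₁ where
  field
    tiling    : Fin N → SpotSet
    tiles     : ∀ i → Tiled∅ B (tiling i)
    injective : ∀ i j → tiling i ≐ tiling j → i ≡ j
    complete  : ∀ S → Tiled∅ B S → ∃ λ i → S ≐ tiling i
open Enum

enum-by : ∀ {B : Region} {I : Set} {N} → Fin N ↔ I → (w : I → SpotSet) →
          (∀ i → Tiled∅ B (w i)) → (∀ i j → w i ≐ w j → i ≡ j) → (∀ S → Tiled∅ B S → ∃ λ i → S ≐ w i) →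
          Enum B N
enum-by e w w-tiles w-inj w-complete = record
  { tiling    = λ k → w (to k)
  ; tiles     = λ k → w-tiles (to k)
  ; injective = λ k k' eq → trans (sym (strictlyInverseʳ k)) (trans (cong from (w-inj _ _ eq)) (strictlyInverseʳ k'))
  ; complete  = λ S t → let (i , eqv) = w-complete S t in
                  from i , ≐-trans eqv (subst (λ z → w i ≐ w z) (sym (strictlyInverseˡ i)) ≐-refl) }
  where open Inverse e

cancel-first : ∀ {L A B A' B'} {P₁ P₂ : Region} →
  (∀ x → A x → P₁ (proj₁ x)) → (∀ x → A' x → P₁ (proj₁ x)) →
  (∀ x → B x → P₂ (proj₁ x)) → (∀ x → B' x → P₂ (proj₁ x)) →
  (∀ a → P₁ a → P₂ a → ⊥) → ¬ P₁ (proj₁ L) → ¬ P₂ (proj₁ L) →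
  (⟦ L ⟧ ∪S (A ∪S B)) ≐ (⟦ L ⟧ ∪S (A' ∪S B')) → A ≐ A' × B ≐ B'
cancel-first {L} {A} {B} {A'} {B'} {P₁} {P₂} hA hA' hB hB' disj ¬L₁ ¬L₂ e =
  (λ x → left {A} {B} {A'} {B'} x (proj₁ (e x)) hA hB' , left {A'} {B'} {A} {B} x (proj₂ (e x)) hA' hB) ,
  (λ x → right {A} {B} {A'} {B'} x (proj₁ (e x)) hB hA' , right {A'} {B'} {A} {B} x (proj₂ (e x)) hB' hA)
  where
    left : ∀ {X Y Z W} x → ((⟦ L ⟧ ∪S (X ∪S Y)) x → (⟦ L ⟧ ∪S (Z ∪S W)) x) →
           (∀ x → X x → P₁ (proj₁ x)) → (∀ x → W x → P₂ (proj₁ x)) → X x → Z x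
    left x to hX hW a with to (inj₂ (inj₁ a))
    ... | inj₁ refl        = ⊥-elim (¬L₁ (hX x a))
    ... | inj₂ (inj₁ a')   = a'
    ... | inj₂ (inj₂ b')   = ⊥-elim (disj _ (hX x a) (hW x b'))
    right : ∀ {X Y Z W} x → ((⟦ L ⟧ ∪S (X ∪S Y)) x → (⟦ L ⟧ ∪S (Z ∪S W)) x) →
            (∀ x → Y x → P₂ (proj₁ x)) → (∀ x → Z x → P₁ (proj₁ x)) → Y x → W x
    right x to hY hZ b with to (inj₂ (inj₂ b))
    ... | inj₁ refl        = ⊥-elim (¬L₂ (hY x b))
    ... | inj₂ (inj₁ a')   = ⊥-elim (disj _ (hZ x a') (hY x b))
    ... | inj₂ (inj₂ b')   = b'

∅-starts : ∀ x → ∅S x → ∅R (proj₁ x)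
∅-starts x ()

-- T p q: the number of spotlight tilings of a p × q box, by the recursion
-- "top row or left column first" (both coincide for a single square).
T : ℕ → ℕ → ℕ
T zero          q             = 1
T (suc p)       zero          = 1
T (suc zero)    (suc zero)    = 1
T (suc zero)    (suc (suc q)) = T 0 (suc (suc q)) + T 1 (suc q)
T (suc (suc p)) (suc q)       = T (suc p) (suc q) + T (suc (suc p)) q

enum-empty : ∀ {B} → (∀ a → ¬ B a) → Enum B 1
enum-empty em = record
  { tiling = λ _ → ∅S ; tiles = λ _ → inj₂ (em , ≐-refl) ; injective = λ { fzero fzero _ → refl }
  ; complete = λ S t → fzero , tiled∅-empty em t }

-- A single square has one tiling: its two spotlights coincide.
enum-square : ∀ r c → Enum (Box r c 1 1) 1
enum-square r c = record
  { tiling = λ _ → v ; tiles = λ _ → inj₁ (box-buildE (inj₂ (box-empty₁ , ≐-refl)))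
  ; injective = λ { fzero fzero _ → refl } ; complete = all-v }
  where
    v = ⟦ spot (r , c) East 0 ⟧ ∪S (∅S ∪S ∅S)
    south≡east : spot (r , c) South 0 ≡ spot (r , c) East 0
    south≡east = cong₂ (λ a b → ((r , c) , (a , b))) (+-identityʳ r) (sym (+-identityʳ c))
    all-v : ∀ S → Tiled∅ (Box r c 1 1) S → ∃ λ i → S ≐ v
    all-v S (inj₂ (em , _)) = ⊥-elim (em (r , c) (proj₁ (box-nwc r c 0 0)))
    all-v S (inj₁ t) with box-decompose t
    ... | inj₁ (S₁ , t₁ , e) = fzero , ≐-trans e (∪-cong ≐-refl (∪-cong (tiled∅-empty box-empty₁ t₁) ≐-refl))
    ... | inj₂ (S₁ , t₁ , e) = fzero , ≐-trans e (∪-cong (λ x → (λ eq → trans eq south≡east) , (λ eq → trans eq (sym south≡east)))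
                                                   (∪-cong (tiled∅-empty box-empty₂ t₁) ≐-refl))

-- For a box larger than one square, the row-first and the column-first
-- tilings are different, so their numbers add up.
enum-box-step : ∀ r c p q {a b} → Enum (Box (suc r) c p (suc q)) a → Enum (Box r (suc c) (suc p) q) b →
                ¬ (p ≡ 0 × q ≡ 0) → Enum (Box r c (suc p) (suc q)) (a + b)
enum-box-step r c p q {a} {b} Ea Eb big = enum-by (+↔⊎ {a} {b}) w w-tiles w-inj w-complete
  where
    open Enum Ea renaming (tiling to va; tiles to ta; injective to ia; complete to ca)
    open Enum Eb renaming (tiling to vb; tiles to tb; injective to ib; complete to cb)
    LE = spot (r , c) East q
    LS = spot (r , c) South p
    w : Fin a ⊎ Fin b → SpotSet
    w (inj₁ i) = ⟦ LE ⟧ ∪S (va i ∪S ∅S)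
    w (inj₂ j) = ⟦ LS ⟧ ∪S (vb j ∪S ∅S)
    w-tiles : ∀ i → Tiled∅ (Box r c (suc p) (suc q)) (w i)
    w-tiles (inj₁ i) = inj₁ (box-buildE (ta i))
    w-tiles (inj₂ j) = inj₁ (box-buildS (tb j))
    ¬below : ¬ Box (suc r) c p (suc q) (r , c)
    ¬below ((x , _) , _) = <-irrefl refl x
    ¬right : ¬ Box r (suc c) (suc p) q (r , c)
    ¬right (_ , (x , _)) = <-irrefl refl x
    no-offset : ∀ x {k} → x + k ≡ x → k ≡ 0
    no-offset x eq = +-cancelˡ-≡ x _ 0 (trans eq (sym (+-identityʳ x)))
    -- LE ≠ LS since the box is not a single square, and LE does not start to
    -- the right of (r , c).
    row≢col : ∀ i j → w (inj₁ i) ≐ w (inj₂ j) → ⊥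
    row≢col i j e with proj₁ (e LE) (inj₁ refl)
    ... | inj₁ eq = big (no-offset r (sym (cong (λ z → proj₁ (proj₂ z)) eq)) , no-offset c (cong (λ z → proj₂ (proj₂ z)) eq))
    ... | inj₂ (inj₁ x) = ¬right (start∈ (tb j) LE x)
    ... | inj₂ (inj₂ ())
    w-inj : ∀ i j → w i ≐ w j → i ≡ j
    w-inj (inj₁ i) (inj₁ i') e = cong inj₁ (ia i i' (proj₁ (cancel-first (start∈ (ta i)) (start∈ (ta i')) ∅-starts ∅-starts (λ _ _ ()) ¬below (λ ()) e)))
    w-inj (inj₂ j) (inj₂ j') e = cong inj₂ (ib j j' (proj₁ (cancel-first (start∈ (tb j)) (start∈ (tb j')) ∅-starts ∅-starts (λ _ _ ()) ¬right (λ ()) e)))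
    w-inj (inj₁ i) (inj₂ j) e = ⊥-elim (row≢col i j e)
    w-inj (inj₂ j) (inj₁ i) e = ⊥-elim (row≢col i j (≐-sym e))
    w-complete : ∀ S → Tiled∅ (Box r c (suc p) (suc q)) S → ∃ λ i → S ≐ w i
    w-complete S (inj₂ (em , _)) = ⊥-elim (em (r , c) (proj₁ (box-nwc r c p q)))
    w-complete S (inj₁ t) with box-decompose t
    ... | inj₁ (S₁ , t₁ , e) = let (i , e') = ca S₁ t₁ in inj₁ i , ≐-trans e (∪-cong ≐-refl (∪-cong e' ≐-refl))
    ... | inj₂ (S₁ , t₁ , e) = let (j , e') = cb S₁ t₁ in inj₂ j , ≐-trans e (∪-cong ≐-refl (∪-cong e' ≐-refl))

boxEnum : ∀ r c p q → Enum (Box r c p q) (T p q)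
boxEnum r c zero          q             = enum-empty box-empty₁
boxEnum r c (suc p)       zero          = enum-empty box-empty₂
boxEnum r c (suc zero)    (suc zero)    = enum-square r c
boxEnum r c (suc zero)    (suc (suc q)) =
  enum-box-step r c 0 (suc q) (boxEnum (suc r) c 0 (suc (suc q))) (boxEnum r (suc c) 1 (suc q)) (λ { (_ , ()) })
boxEnum r c (suc (suc p)) (suc q)       =
  enum-box-step r c (suc p) q (boxEnum (suc r) c (suc p) (suc q)) (boxEnum r (suc c) (suc (suc p)) q) (λ { (() , _) })

count-≤ : ∀ {R N N'} → NumTilings R N → NumTilings R N' → N ≤ N'
count-≤ {R} {N} {N'} (v , t , inj , c) (v' , t' , inj' , c') = injective⇒≤ {f = g} g-inj
  where
    g : Fin N → Fin N'
    g i = proj₁ (c' (v i) (t i))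
    g-inj : ∀ {i j} → g i ≡ g j → i ≡ j
    g-inj {i} {j} eq = inj i j (≐-trans (proj₂ (c' (v i) (t i)))
       (≐-trans (subst (λ k → v' (g i) ≐ v' k) eq ≐-refl) (≐-sym (proj₂ (c' (v j) (t j))))))

count-unique : ∀ {R N N'} → NumTilings R N → NumTilings R N' → N ≡ N'
count-unique a b = ≤-antisym (count-≤ a b) (count-≤ b a)

num-transport : ∀ {R R' N} → R ≅ R' → NumTilings R N → NumTilings R' N
num-transport e (v , t , inj , c) =
  v , (λ i → transport e ≐-refl (t i)) , inj , (λ S tS → c S (transport (≅-sym e) ≐-refl tS))

enum⇒num : ∀ {B N} → Σ Square B → Enum B N → NumTilings B N
enum⇒num inh E = tiling E , (λ i → tiled∅⇒tiled inh (tiles E i)) , injective E , (λ S tS → complete E S (inj₁ tS))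

TCount⇒T : ∀ p q t → TCount p q t → t ≡ T p q
TCount⇒T zero    q       t (lift eq) = eq
TCount⇒T (suc p) zero    t (lift eq) = eq
TCount⇒T (suc p) (suc q) t nt = count-unique nt
  (num-transport (≅-sym (rect≅box (suc p) (suc q)))
     (enum⇒num ((0 , 0) , proj₁ (box-nwc 0 0 p q)) (boxEnum 0 0 (suc p) (suc q))))

nest-swap : ∀ {L L' : Spot} {Y : SpotSet} →
  (⟦ L ⟧ ∪S ((⟦ L' ⟧ ∪S (Y ∪S ∅S)) ∪S ∅S)) ≐ (⟦ L' ⟧ ∪S ((⟦ L ⟧ ∪S (Y ∪S ∅S)) ∪S ∅S))
nest-swap {L} {L'} {Y} x = swap {L} {L'} , swap {L'} {L}
  where
    swap : ∀ {K K' : Spot} → (⟦ K ⟧ ∪S ((⟦ K' ⟧ ∪S (Y ∪S ∅S)) ∪S ∅S)) x → (⟦ K' ⟧ ∪S ((⟦ K ⟧ ∪S (Y ∪S ∅S)) ∪S ∅S)) x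
    swap (inj₁ e)                = inj₂ (inj₁ (inj₁ e))
    swap (inj₂ (inj₁ (inj₁ e)))  = inj₁ e
    swap (inj₂ (inj₁ (inj₂ y)))  = inj₂ (inj₁ (inj₂ y))
    swap (inj₂ (inj₂ ()))

nest-split : ∀ {L L' : Spot} {Y : SpotSet} →
  (⟦ L ⟧ ∪S ((⟦ L' ⟧ ∪S (Y ∪S ∅S)) ∪S ∅S)) ≐ (⟦ L' ⟧ ∪S ((⟦ L ⟧ ∪S (∅S ∪S ∅S)) ∪S Y))
nest-split {L} {L'} {Y} x = there , back
  where
    there : (⟦ L ⟧ ∪S ((⟦ L' ⟧ ∪S (Y ∪S ∅S)) ∪S ∅S)) x → (⟦ L' ⟧ ∪S ((⟦ L ⟧ ∪S (∅S ∪S ∅S)) ∪S Y)) x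
    there (inj₁ e)                       = inj₂ (inj₁ (inj₁ e))
    there (inj₂ (inj₁ (inj₁ e)))         = inj₁ e
    there (inj₂ (inj₁ (inj₂ (inj₁ y))))  = inj₂ (inj₂ y)
    there (inj₂ (inj₁ (inj₂ (inj₂ ()))))
    there (inj₂ (inj₂ ()))
    back : (⟦ L' ⟧ ∪S ((⟦ L ⟧ ∪S (∅S ∪S ∅S)) ∪S Y)) x → (⟦ L ⟧ ∪S ((⟦ L' ⟧ ∪S (Y ∪S ∅S)) ∪S ∅S)) x
    back (inj₁ e)                        = inj₂ (inj₁ (inj₁ e))
    back (inj₂ (inj₁ (inj₁ e)))          = inj₁ e
    back (inj₂ (inj₁ (inj₂ (inj₁ ()))))
    back (inj₂ (inj₁ (inj₂ (inj₂ ()))))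
    back (inj₂ (inj₂ y))                 = inj₂ (inj₁ (inj₂ (inj₁ y)))

module Punctured (a b : ℕ) where
  Punct : Region
  Punct = RectNW (suc (suc a)) (suc (suc b))

  ≢origin₁ : ∀ {i j : ℕ} → _≢_ {A = Square} (suc i , j) (0 , 0)
  ≢origin₁ ()
  ≢origin₂ : ∀ {i j : ℕ} → _≢_ {A = Square} (i , suc j) (0 , 0)
  ≢origin₂ ()

  corners : ∀ {i j} → NWCorner Punct (i , j) → ((i , j) ≡ (0 , 1)) ⊎ ((i , j) ≡ (1 , 0))
  corners {zero}        {zero}        (((_ , _) , ne) , _) = ⊥-elim (ne refl)
  corners {zero}        {suc zero}    _ = inj₁ refl
  corners {zero}        {suc (suc j)} (((il , jl) , _) , _ , n2) = ⊥-elim (n2 (suc j) refl ((il , <-trans (n<1+n _) jl) , ≢origin₂))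
  corners {suc zero}    {zero}        _ = inj₂ refl
  corners {suc (suc i)} {zero}        (((il , jl) , _) , n1 , _) = ⊥-elim (n1 (suc i) refl ((<-trans (n<1+n _) il , jl) , ≢origin₁))
  corners {suc i}       {suc j}       (((il , jl) , _) , _ , n2) = ⊥-elim (n2 j refl ((il , <-trans (n<1+n _) jl) , ≢origin₁))

  corner₀₁ : NWCorner Punct (0 , 1)
  corner₀₁ = ((s≤s z≤n , s≤s (s≤s z≤n)) , ≢origin₂) , (λ i' ()) , (λ { j' refl ((_ , _) , ne) → ne refl })
  corner₁₀ : NWCorner Punct (1 , 0)
  corner₁₀ = ((s≤s (s≤s z≤n) , s≤s z≤n) , ≢origin₁) , (λ { i' refl ((_ , _) , ne) → ne refl }) , (λ j' ())

  L₁ L₂ L₃ L₄ : Spot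
  L₁ = spot (0 , 1) East b
  L₂ = spot (0 , 1) South (suc a)
  L₃ = spot (1 , 0) East (suc b)
  L₄ = spot (1 , 0) South a

  run₁ : MaxRun Punct (0 , 1) East b
  run₁ = (λ k k≤ → (s≤s z≤n , s≤s (s≤s k≤)) , ≢origin₂) , (λ ((_ , lt) , _) → <-irrefl refl lt)
  run₂ : MaxRun Punct (0 , 1) South (suc a)
  run₂ = (λ k k≤ → (s≤s k≤ , s≤s (s≤s z≤n)) , ≢origin₂) , (λ ((lt , _) , _) → <-irrefl refl lt)
  run₃ : MaxRun Punct (1 , 0) East (suc b)
  run₃ = (λ k k≤ → (s≤s (s≤s z≤n) , s≤s k≤) , ≢origin₁) , (λ ((_ , lt) , _) → <-irrefl refl lt)
  run₄ : MaxRun Punct (1 , 0) South a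
  run₄ = (λ k k≤ → (s≤s (s≤s k≤) , s≤s z≤n) , ≢origin₁) , (λ ((lt , _) , _) → <-irrefl refl lt)

  B₁ : Region
  B₁ = Box 1 0 (suc a) (suc (suc b))
  split₁ : Split (Punct ∖ L₁) B₁ ∅R
  split₁ = split-one into from (box-conn 1 0 (suc a) (suc (suc b)))
    where
      into : ∀ t → (Punct ∖ L₁) t → B₁ t
      into (zero , zero)  ((_ , ne) , _) = ⊥-elim (ne refl)
      into (zero , suc j) (((il , jl) , ne) , nin) = ⊥-elim (nin ((z≤n , z≤n) , (s≤s z≤n , ≤-pred jl)))
      into (suc i , j)    (((il , jl) , ne) , nin) = (s≤s z≤n , il) , (z≤n , jl)
      from : ∀ t → B₁ t → (Punct ∖ L₁) t
      from (suc i , j) ((_ , il) , (_ , jl)) = ((il , jl) , ≢origin₁) , λ { ((_ , ()) , _) }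

  B₄ : Region
  B₄ = Box 0 1 (suc (suc a)) (suc b)
  split₄ : Split (Punct ∖ L₄) B₄ ∅R
  split₄ = split-one into from (box-conn 0 1 (suc (suc a)) (suc b))
    where
      into : ∀ t → (Punct ∖ L₄) t → B₄ t
      into (zero , zero)  ((_ , ne) , _) = ⊥-elim (ne refl)
      into (suc i , zero) (((il , jl) , ne) , nin) = ⊥-elim (nin ((s≤s z≤n , ≤-pred il) , (z≤n , z≤n)))
      into (i , suc j)    (((il , jl) , ne) , nin) = (z≤n , il) , (s≤s z≤n , jl)
      from : ∀ t → B₄ t → (Punct ∖ L₄) t
      from (i , suc j) ((_ , il) , (_ , jl)) = ((il , jl) , ≢origin₂) , λ { (_ , (_ , ())) }

  B₂₁ : Region
  B₂₁ = Box 1 0 (suc a) 1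
  B₂₂ : Region
  B₂₂ = Box 0 2 (suc (suc a)) b
  split₂ : Split (Punct ∖ L₂) B₂₁ B₂₂
  split₂ = record { split = into ; inc₁ = from₁ ; inc₂ = from₂ ; conn₁ = box-conn 1 0 (suc a) 1
                  ; conn₂ = box-conn 0 2 (suc (suc a)) b ; clos₁ = closed ; disj = apart }
    where
      into : ∀ t → (Punct ∖ L₂) t → B₂₁ t ⊎ B₂₂ t
      into (zero , zero)        ((_ , ne) , _) = ⊥-elim (ne refl)
      into (suc i , zero)       (((il , jl) , ne) , nin) = inj₁ ((s≤s z≤n , il) , (z≤n , s≤s z≤n))
      into (i , suc zero)       (((il , jl) , ne) , nin) = ⊥-elim (nin ((z≤n , ≤-pred il) , (s≤s z≤n , s≤s z≤n)))
      into (i , suc (suc j))    (((il , jl) , ne) , nin) = inj₂ ((z≤n , il) , (s≤s (s≤s z≤n) , jl))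
      from₁ : ∀ t → B₂₁ t → (Punct ∖ L₂) t
      from₁ (suc i , zero) ((_ , il) , _) = ((il , s≤s z≤n) , ≢origin₁) , λ { (_ , (() , _)) }
      from₁ (_ , suc j) (_ , (_ , s≤s ()))
      from₂ : ∀ t → B₂₂ t → (Punct ∖ L₂) t
      from₂ (i , suc (suc j)) ((_ , il) , (_ , jl)) = ((il , jl) , ≢origin₂) , λ { (_ , (_ , s≤s ())) }
      from₂ (i , suc zero) (_ , (s≤s () , _))
      closed : ∀ {x y} → (Punct ∖ L₂) x → (Punct ∖ L₂) y → Adj x y → B₂₁ x → B₂₁ y
      closed _ (((il , _) , _) , nin) (east i j) (_ , (_ , s≤s z≤n)) = ⊥-elim (nin ((z≤n , ≤-pred il) , (s≤s z≤n , s≤s z≤n)))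
      closed _ _ (west i j) (_ , (_ , s≤s ()))
      closed _ (((il , _) , _) , _) (south i j) ((_ , _) , h) = (s≤s z≤n , il) , h
      closed _ ((_ , ne) , _) (north zero j) (_ , (_ , s≤s z≤n)) = ⊥-elim (ne refl)
      closed _ (((il , _) , _) , _) (north (suc i) j) (_ , h) = (s≤s z≤n , il) , h
      apart : ∀ t → B₂₁ t → B₂₂ t → ⊥
      apart (i , j) (_ , (_ , s≤s j0)) (_ , (s≤s (s≤s _) , _)) with j0
      ... | ()

  B₃₁ : Region
  B₃₁ = Box 0 1 1 (suc b)
  B₃₂ : Region
  B₃₂ = Box 2 0 a (suc (suc b))
  split₃ : Split (Punct ∖ L₃) B₃₁ B₃₂
  split₃ = record { split = into ; inc₁ = from₁ ; inc₂ = from₂ ; conn₁ = box-conn 0 1 1 (suc b)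
                  ; conn₂ = box-conn 2 0 a (suc (suc b)) ; clos₁ = closed ; disj = apart }
    where
      into : ∀ t → (Punct ∖ L₃) t → B₃₁ t ⊎ B₃₂ t
      into (zero , zero)     ((_ , ne) , _) = ⊥-elim (ne refl)
      into (zero , suc j)    (((il , jl) , ne) , nin) = inj₁ ((z≤n , s≤s z≤n) , (s≤s z≤n , jl))
      into (suc zero , j)    (((il , jl) , ne) , nin) = ⊥-elim (nin ((s≤s z≤n , s≤s z≤n) , (z≤n , ≤-pred jl)))
      into (suc (suc i) , j) (((il , jl) , ne) , nin) = inj₂ ((s≤s (s≤s z≤n) , il) , (z≤n , jl))
      from₁ : ∀ t → B₃₁ t → (Punct ∖ L₃) t
      from₁ (zero , suc j) (_ , (_ , jl)) = ((s≤s z≤n , jl) , ≢origin₂) , λ { ((() , _) , _) }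
      from₁ (suc i , _) ((_ , s≤s ()) , _)
      from₂ : ∀ t → B₃₂ t → (Punct ∖ L₃) t
      from₂ (suc (suc i) , j) ((_ , il) , (_ , jl)) = ((il , jl) , ≢origin₁) , λ { ((_ , s≤s ()) , _) }
      from₂ (suc zero , j) ((s≤s () , _) , _)
      closed : ∀ {x y} → (Punct ∖ L₃) x → (Punct ∖ L₃) y → Adj x y → B₃₁ x → B₃₁ y
      closed _ (((_ , jl) , _) , _) (east i j) (h , (_ , _)) = h , (s≤s z≤n , jl)
      closed _ ((_ , ne) , _) (west i zero) ((_ , s≤s z≤n) , _) = ⊥-elim (ne refl)
      closed _ (((_ , jl) , _) , _) (west i (suc j)) (h , _) = h , (s≤s z≤n , jl)
      closed _ (((_ , jl) , _) , nin) (south i j) ((_ , s≤s z≤n) , _) = ⊥-elim (nin ((s≤s z≤n , s≤s z≤n) , (z≤n , ≤-pred jl)))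
      closed _ _ (north i j) ((_ , s≤s ()) , _)
      apart : ∀ t → B₃₁ t → B₃₂ t → ⊥
      apart (i , j) ((_ , s≤s i0) , _) ((s≤s (s≤s _) , _) , _) with i0
      ... | ()

  -- The tilings of the punctured rectangle fall into three families:
  --   inner : L₁ and L₄, and a tiling of the (a+1) × (b+1) box Box 1 1;
  --   row   : L₃, a tiling of the top row B₃₁ and of the box B₃₂ below;
  --   col   : L₂, a tiling of the left column B₂₁ and of the box B₂₂.
  -- (Starting with L₁ or L₄ the rest is a box, whose own first spotlight
  -- either completes the "inner" family or is L₃ resp. L₂.)
  A D₁ D₂ C₁ C₂ : ℕ
  A  = T (suc a) (suc b)
  D₁ = T 1 (suc b)
  D₂ = T a (suc (suc b))
  C₁ = T (suc a) 1
  C₂ = T (suc (suc a)) b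

  Inner : Region
  Inner = Box 1 1 (suc a) (suc b)

  enumInner : Enum Inner A
  enumInner = boxEnum 1 1 (suc a) (suc b)
  enumRow : Enum B₃₁ D₁
  enumRow = boxEnum 0 1 1 (suc b)
  enumBelow : Enum B₃₂ D₂
  enumBelow = boxEnum 2 0 a (suc (suc b))
  enumCol : Enum B₂₁ C₁
  enumCol = boxEnum 1 0 (suc a) 1
  enumRight : Enum B₂₂ C₂
  enumRight = boxEnum 0 2 (suc (suc a)) b

  Index : Set
  Index = (Fin A ⊎ (Fin D₁ × Fin D₂)) ⊎ (Fin C₁ × Fin C₂)

  family : Index → SpotSet
  family (inj₁ (inj₁ y))      = ⟦ L₁ ⟧ ∪S ((⟦ L₄ ⟧ ∪S (tiling enumInner y ∪S ∅S)) ∪S ∅S)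
  family (inj₁ (inj₂ (x , z))) = ⟦ L₃ ⟧ ∪S (tiling enumRow x ∪S tiling enumBelow z)
  family (inj₂ (x , z))       = ⟦ L₂ ⟧ ∪S (tiling enumCol x ∪S tiling enumRight z)

  below-L₁ : ∀ y → Tiled∅ B₁ (⟦ L₄ ⟧ ∪S (tiling enumInner y ∪S ∅S))
  below-L₁ y = inj₁ (box-buildS (tiles enumInner y))

  family-tiles : ∀ i → Tiled Punct (family i)
  family-tiles (inj₁ (inj₁ y))      = FirstSpot.build {s = 0 , 1} {d = East} {ℓ = b} split₁ corner₀₁ run₁ (below-L₁ y) ∅-tiled
  family-tiles (inj₁ (inj₂ (x , z))) = FirstSpot.build {s = 1 , 0} {d = East} {ℓ = suc b} split₃ corner₁₀ run₃ (tiles enumRow x) (tiles enumBelow z)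
  family-tiles (inj₂ (x , z))       = FirstSpot.build {s = 0 , 1} {d = South} {ℓ = suc a} split₂ corner₀₁ run₂ (tiles enumCol x) (tiles enumRight z)

  -- The three families are disjoint: L₄ starts in none of the blocks of a
  -- row-family tiling, L₁ in none of a col-family one, and L₂ only ends in
  -- B₃₂ but starts at row 0.
  inner≢row : ∀ y x z → family (inj₁ (inj₁ y)) ≐ family (inj₁ (inj₂ (x , z))) → ⊥
  inner≢row y x z e with proj₁ (e L₄) (inj₂ (inj₁ (inj₁ refl)))
  ... | inj₁ ()
  ... | inj₂ (inj₁ h) with start∈ (tiles enumRow x) L₄ h
  ... | ((_ , s≤s ()) , _)
  inner≢row y x z e | inj₂ (inj₂ h) with start∈ (tiles enumBelow z) L₄ h
  ... | ((s≤s () , _) , _)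

  inner≢col : ∀ y x z → family (inj₁ (inj₁ y)) ≐ family (inj₂ (x , z)) → ⊥
  inner≢col y x z e with proj₁ (e L₁) (inj₁ refl)
  ... | inj₁ ()
  ... | inj₂ (inj₁ h) with start∈ (tiles enumCol x) L₁ h
  ... | ((() , _) , _)
  inner≢col y x z e | inj₂ (inj₂ h) with start∈ (tiles enumRight z) L₁ h
  ... | (_ , (s≤s () , _))

  row≢col : ∀ x z x' z' → family (inj₁ (inj₂ (x , z))) ≐ family (inj₂ (x' , z')) → ⊥
  row≢col x z x' z' e with proj₂ (e L₂) (inj₁ refl)
  ... | inj₁ ()
  ... | inj₂ (inj₁ h) with proj₂ (tiled∅-ends (tiles enumRow x) L₂ h)
  ... | ((_ , s≤s ()) , _)
  row≢col x z x' z' e | inj₂ (inj₂ h) with start∈ (tiles enumBelow z) L₂ h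
  ... | ((() , _) , _)

  family-injective : ∀ i j → family i ≐ family j → i ≡ j
  family-injective (inj₁ (inj₁ y)) (inj₁ (inj₁ y')) e =
    let e₁ = proj₁ (cancel-first {P₁ = B₁} {P₂ = ∅R} (start∈ (below-L₁ y)) (start∈ (below-L₁ y')) ∅-starts ∅-starts
                                  (λ _ _ ()) (λ { ((() , _) , _) }) (λ ()) e)
        e₂ = proj₁ (cancel-first {P₁ = Inner} {P₂ = ∅R} (start∈ (tiles enumInner y)) (start∈ (tiles enumInner y'))
                                  ∅-starts ∅-starts (λ _ _ ()) (λ { (_ , (() , _)) }) (λ ()) e₁)
    in cong (λ u → inj₁ (inj₁ u)) (injective enumInner y y' e₂)
  family-injective (inj₁ (inj₂ (x , z))) (inj₁ (inj₂ (x' , z'))) e =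
    let c = cancel-first {P₁ = B₃₁} {P₂ = B₃₂} (start∈ (tiles enumRow x)) (start∈ (tiles enumRow x'))
              (start∈ (tiles enumBelow z)) (start∈ (tiles enumBelow z'))
              (Split.disj split₃) (λ { ((_ , s≤s ()) , _) }) (λ { ((s≤s () , _) , _) }) e
    in cong (λ u → inj₁ (inj₂ u)) (cong₂ _,_ (injective enumRow x x' (proj₁ c)) (injective enumBelow z z' (proj₂ c)))
  family-injective (inj₂ (x , z)) (inj₂ (x' , z')) e =
    let c = cancel-first {P₁ = B₂₁} {P₂ = B₂₂} (start∈ (tiles enumCol x)) (start∈ (tiles enumCol x'))
              (start∈ (tiles enumRight z)) (start∈ (tiles enumRight z'))
              (Split.disj split₂) (λ { ((() , _) , _) }) (λ { (_ , (s≤s () , _)) }) e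
    in cong inj₂ (cong₂ _,_ (injective enumCol x x' (proj₁ c)) (injective enumRight z z' (proj₂ c)))
  family-injective (inj₁ (inj₁ y)) (inj₁ (inj₂ (x , z))) e = ⊥-elim (inner≢row y x z e)
  family-injective (inj₁ (inj₂ (x , z))) (inj₁ (inj₁ y)) e = ⊥-elim (inner≢row y x z (≐-sym e))
  family-injective (inj₁ (inj₁ y)) (inj₂ (x , z)) e        = ⊥-elim (inner≢col y x z e)
  family-injective (inj₂ (x , z)) (inj₁ (inj₁ y)) e        = ⊥-elim (inner≢col y x z (≐-sym e))
  family-injective (inj₁ (inj₂ (x , z))) (inj₂ (x' , z')) e = ⊥-elim (row≢col x z x' z' e)
  family-injective (inj₂ (x' , z')) (inj₁ (inj₂ (x , z))) e = ⊥-elim (row≢col x z x' z' (≐-sym e))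

  L₁-alone : Tiled∅ B₃₁ (⟦ L₁ ⟧ ∪S (∅S ∪S ∅S))
  L₁-alone = inj₁ (box-buildE (inj₂ (box-empty₁ , ≐-refl)))
  L₄-alone : Tiled∅ B₂₁ (⟦ L₄ ⟧ ∪S (∅S ∪S ∅S))
  L₄-alone = inj₁ (box-buildS (inj₂ (box-empty₂ , ≐-refl)))

  from-L₁ : ∀ {S S₁ S₂} → Tiled∅ B₁ S₁ → Tiled∅ ∅R S₂ → S ≐ (⟦ L₁ ⟧ ∪S (S₁ ∪S S₂)) → ∃ λ i → S ≐ family i
  from-L₁ t₁ t₂ e with box-decompose (tiled∅⇒tiled ((1 , 0) , proj₁ (box-nwc 1 0 a (suc b))) t₁)
  ... | inj₁ (S' , t' , e') =
    let (x , ex) = complete enumRow _ L₁-alone ; (z , ez) = complete enumBelow S' t' in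
    inj₁ (inj₂ (x , z)) ,
    ≐-trans e (≐-trans (∪-cong ≐-refl (∪-cong e' (tiled∅-empty (λ a ()) t₂)))
              (≐-trans nest-split (∪-cong ≐-refl (∪-cong ex ez))))
  ... | inj₂ (S' , t' , e') =
    let (y , ey) = complete enumInner S' t' in
    inj₁ (inj₁ y) ,
    ≐-trans e (∪-cong ≐-refl (∪-cong (≐-trans e' (∪-cong ≐-refl (∪-cong ey ≐-refl))) (tiled∅-empty (λ a ()) t₂)))

  from-L₄ : ∀ {S S₁ S₂} → Tiled∅ B₄ S₁ → Tiled∅ ∅R S₂ → S ≐ (⟦ L₄ ⟧ ∪S (S₁ ∪S S₂)) → ∃ λ i → S ≐ family i
  from-L₄ t₁ t₂ e with box-decompose (tiled∅⇒tiled ((0 , 1) , proj₁ (box-nwc 0 1 (suc a) b)) t₁)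
  ... | inj₁ (S' , t' , e') =
    let (y , ey) = complete enumInner S' t' in
    inj₁ (inj₁ y) ,
    ≐-trans e (≐-trans (∪-cong ≐-refl (∪-cong e' (tiled∅-empty (λ a ()) t₂)))
              (≐-trans nest-swap (∪-cong ≐-refl (∪-cong (∪-cong ≐-refl (∪-cong ey ≐-refl)) ≐-refl))))
  ... | inj₂ (S' , t' , e') =
    let (x , ex) = complete enumCol _ L₄-alone ; (z , ez) = complete enumRight S' t' in
    inj₂ (x , z) ,
    ≐-trans e (≐-trans (∪-cong ≐-refl (∪-cong e' (tiled∅-empty (λ a ()) t₂)))
              (≐-trans nest-split (∪-cong ≐-refl (∪-cong ex ez))))

  from-L₂ : ∀ {S S₁ S₂} → Tiled∅ B₂₁ S₁ → Tiled∅ B₂₂ S₂ → S ≐ (⟦ L₂ ⟧ ∪S (S₁ ∪S S₂)) → ∃ λ i → S ≐ family i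
  from-L₂ t₁ t₂ e =
    let (x , ex) = complete enumCol _ t₁ ; (z , ez) = complete enumRight _ t₂ in
    inj₂ (x , z) , ≐-trans e (∪-cong ≐-refl (∪-cong ex ez))

  from-L₃ : ∀ {S S₁ S₂} → Tiled∅ B₃₁ S₁ → Tiled∅ B₃₂ S₂ → S ≐ (⟦ L₃ ⟧ ∪S (S₁ ∪S S₂)) → ∃ λ i → S ≐ family i
  from-L₃ t₁ t₂ e =
    let (x , ex) = complete enumRow _ t₁ ; (z , ez) = complete enumBelow _ t₂ in
    inj₁ (inj₂ (x , z)) , ≐-trans e (∪-cong ≐-refl (∪-cong ex ez))

  family-complete : ∀ S → Tiled Punct S → ∃ λ i → S ≐ family i
  family-complete S (tile _ nw d ℓ mr f fcons fc spec) with corners nw | d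
  ... | inj₁ refl | East with maxrun-unique {R = Punct} {s = 0 , 1} {d = East} (proj₁ run₁) (proj₂ run₁) mr
  ...   | refl with FirstSpot.decompose-by-split {s = 0 , 1} {d = East} {ℓ = b} split₁ f fcons fc spec (box-inhabited? 1 0 (suc a) (suc (suc b))) ∅R-inhabited?
  ...     | _ , _ , t₁ , t₂ , e = from-L₁ t₁ t₂ e
  family-complete S (tile _ nw d ℓ mr f fcons fc spec) | inj₁ refl | South
    with maxrun-unique {R = Punct} {s = 0 , 1} {d = South} (proj₁ run₂) (proj₂ run₂) mr
  ...   | refl with FirstSpot.decompose-by-split {s = 0 , 1} {d = South} {ℓ = suc a} split₂ f fcons fc spec (box-inhabited? 1 0 (suc a) 1) (box-inhabited? 0 2 (suc (suc a)) b)
  ...     | _ , _ , t₁ , t₂ , e = from-L₂ t₁ t₂ e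
  family-complete S (tile _ nw d ℓ mr f fcons fc spec) | inj₂ refl | East
    with maxrun-unique {R = Punct} {s = 1 , 0} {d = East} (proj₁ run₃) (proj₂ run₃) mr
  ...   | refl with FirstSpot.decompose-by-split {s = 1 , 0} {d = East} {ℓ = suc b} split₃ f fcons fc spec (box-inhabited? 0 1 1 (suc b)) (box-inhabited? 2 0 a (suc (suc b)))
  ...     | _ , _ , t₁ , t₂ , e = from-L₃ t₁ t₂ e
  family-complete S (tile _ nw d ℓ mr f fcons fc spec) | inj₂ refl | South
    with maxrun-unique {R = Punct} {s = 1 , 0} {d = South} (proj₁ run₄) (proj₂ run₄) mr
  ...   | refl with FirstSpot.decompose-by-split {s = 1 , 0} {d = South} {ℓ = a} split₄ f fcons fc spec (box-inhabited? 0 1 (suc (suc a)) (suc b)) ∅R-inhabited?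
  ...     | _ , _ , t₁ , t₂ , e = from-L₄ t₁ t₂ e

  index↔ : Fin (A + D₁ * D₂ + C₁ * C₂) ↔ Index
  index↔ = ↔-trans +↔⊎ (↔-trans +↔⊎ (↔-refl ⊎-↔ *↔×) ⊎-↔ *↔×)

  punctured-count : NumTilings Punct (A + D₁ * D₂ + C₁ * C₂)
  punctured-count = enum⇒num ((0 , 1) , proj₁ corner₀₁)
    (enum-by index↔ family (λ i → inj₁ (family-tiles i)) family-injective
       (λ S t → family-complete S (tiled∅⇒tiled ((0 , 1) , proj₁ corner₀₁) t)))

paths : ℕ → ℕ → ℕ
paths zero    q       = 1
paths (suc p) zero    = 1
paths (suc p) (suc q) = paths p (suc q) + paths (suc p) q

paths-0 : ∀ p → paths p 0 ≡ 1
paths-0 zero    = refl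
paths-0 (suc p) = refl

paths-1 : ∀ q → paths 1 q ≡ suc q
paths-1 zero    = refl
paths-1 (suc q) = cong suc (paths-1 q)

paths-sym : ∀ p q → paths p q ≡ paths q p
paths-sym zero    zero    = refl
paths-sym zero    (suc q) = refl
paths-sym (suc p) zero    = refl
paths-sym (suc p) (suc q) =
  trans (cong₂ _+_ (paths-sym p (suc q)) (paths-sym (suc p) q)) (+-comm (paths (suc q) p) (paths q (suc p)))

paths-binomial : ∀ p q → paths p q ≡ (p + q) C p
paths-binomial zero    q       = refl
paths-binomial (suc p) zero    = sym (trans (cong (_C suc p) (+-identityʳ (suc p))) (nCn≡1 (suc p)))
paths-binomial (suc p) (suc q) = begin
  paths p (suc q) + paths (suc p) q         ≡⟨ cong₂ _+_ (paths-binomial p (suc q)) (paths-binomial (suc p) q) ⟩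
  (p + suc q) C p + (suc p + q) C suc p     ≡⟨ cong (λ z → (p + suc q) C p + z C suc p) (sym (+-suc p q)) ⟩
  (p + suc q) C p + (p + suc q) C suc p     ≡⟨ nCk+nC[k+1]≡[n+1]C[k+1] (p + suc q) p ⟩
  suc (p + suc q) C suc p                   ∎
  where open ≡-Reasoning

paths-absorbˡ : ∀ p q → paths (suc p) q * suc p ≡ paths p q * suc (p + q)
paths-absorbˡ zero    q       = trans (*-identityʳ (paths 1 q)) (trans (paths-1 q) (sym (+-identityʳ (suc q))))
paths-absorbˡ (suc p) zero    = cong (λ z → 1 * suc (suc z)) (sym (+-identityʳ p))
paths-absorbˡ (suc p) (suc q) =
  pascal-step (paths p (suc q)) (paths (suc p) q) (paths (suc (suc p)) q) (paths-absorbˡ p (suc q)) (paths-absorbˡ (suc p) q)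
  where
    -- With A + B = paths (p+1) (q+1) and Y = paths (p+2) q.
    pascal-step : ∀ A B Y → (A + B) * suc p ≡ A * suc (p + suc q) → Y * suc (suc p) ≡ B * suc (suc p + q) →
           ((A + B) + Y) * suc (suc p) ≡ (A + B) * suc (suc p + suc q)
    pascal-step A B Y h₁ h₂ = begin
      ((A + B) + Y) * suc (suc p)                         ≡⟨ solve (A ∷ B ∷ Y ∷ p ∷ []) ⟩
      (A + B) * suc p + (A + B) + Y * suc (suc p)         ≡⟨ cong₂ (λ u v → u + (A + B) + v) h₁ h₂ ⟩
      A * suc (p + suc q) + (A + B) + B * suc (suc p + q) ≡⟨ solve (A ∷ B ∷ p ∷ q ∷ []) ⟩
      (A + B) * suc (suc p + suc q)                       ∎
      where open ≡-Reasoning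

paths-absorbʳ : ∀ p q → paths p (suc q) * suc q ≡ paths p q * suc (p + q)
paths-absorbʳ p q = begin
  paths p (suc q) * suc q ≡⟨ cong (_* suc q) (paths-sym p (suc q)) ⟩
  paths (suc q) p * suc q ≡⟨ paths-absorbˡ q p ⟩
  paths q p * suc (q + p) ≡⟨ cong₂ (λ u v → u * suc v) (paths-sym q p) (+-comm q p) ⟩
  paths p q * suc (p + q) ∎
  where open ≡-Reasoning

T-binom : ∀ p q → T (suc p) (suc q) + paths p q ≡ paths (suc p) (suc q)
T-binom zero    zero    = refl
T-binom zero    (suc q) = cong suc (T-binom 0 q)
T-binom (suc p) zero    = cong (_+ 1) (trans (cong (T (suc p) 1 +_) (sym (paths-0 p))) (T-binom p 0))
T-binom (suc p) (suc q) = begin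
  (T (suc p) (suc (suc q)) + T (suc (suc p)) (suc q)) + (paths p (suc q) + paths (suc p) q)
    ≡⟨ +-interchange (T (suc p) (suc (suc q))) (T (suc (suc p)) (suc q)) (paths p (suc q)) (paths (suc p) q) ⟩
  (T (suc p) (suc (suc q)) + paths p (suc q)) + (T (suc (suc p)) (suc q) + paths (suc p) q)
    ≡⟨ cong₂ _+_ (T-binom p (suc q)) (T-binom (suc p) q) ⟩
  paths (suc p) (suc (suc q)) + paths (suc (suc p)) (suc q) ∎
  where open ≡-Reasoning

T-sym : ∀ p q → T p q ≡ T q p
T-sym zero    zero    = refl
T-sym zero    (suc q) = refl
T-sym (suc p) zero    = refl
T-sym (suc p) (suc q) = +-cancelʳ-≡ (paths p q) _ _ (begin
  T (suc p) (suc q) + paths p q ≡⟨ T-binom p q ⟩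
  paths (suc p) (suc q)         ≡⟨ paths-sym (suc p) (suc q) ⟩
  paths (suc q) (suc p)         ≡⟨ sym (T-binom q p) ⟩
  T (suc q) (suc p) + paths q p ≡⟨ cong (T (suc q) (suc p) +_) (paths-sym q p) ⟩
  T (suc q) (suc p) + paths p q ∎)
  where open ≡-Reasoning

T-row : ∀ q → T 1 (suc q) ≡ suc q
T-row q = +-cancelʳ-≡ 1 _ _ (trans (T-binom 0 q) (trans (paths-1 (suc q)) (+-comm 1 (suc q))))

T-col : ∀ p → T (suc p) 1 ≡ suc p
T-col p = trans (T-sym (suc p) 1) (T-row p)

T-binom₂ : ∀ p q → T p (suc (suc q)) * (suc q * suc (suc q)) + paths p q * p * suc (suc q)
                   ≡ paths p q * suc (p + q) * suc (suc (p + q))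
T-binom₂ zero    q = solve (q ∷ [])
T-binom₂ (suc p) q =
  chain (T (suc p) (suc (suc q))) (paths (suc p) q) (paths p (suc q)) (paths (suc p) (suc (suc q))) (paths (suc p) (suc q))
        (T-binom p (suc q))
        (trans (paths-absorbʳ p q) (sym (paths-absorbˡ p q)))
        (paths-absorbʳ (suc p) (suc q))
        (paths-absorbʳ (suc p) q)
  where
    chain : ∀ t x y z z' → t + y ≡ z → y * suc q ≡ x * suc p →
            z * suc (suc q) ≡ z' * suc (suc p + suc q) → z' * suc q ≡ x * suc (suc p + q) →
            t * (suc q * suc (suc q)) + x * suc p * suc (suc q) ≡ x * suc (suc p + q) * suc (suc (suc p + q))
    chain t x y z z' h₁ h₂ h₃ h₄ = begin
      t * (suc q * suc (suc q)) + x * suc p * suc (suc q) ≡⟨ cong (λ u → t * (suc q * suc (suc q)) + u * suc (suc q)) (sym h₂) ⟩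
      t * (suc q * suc (suc q)) + y * suc q * suc (suc q) ≡⟨ solve (t ∷ y ∷ q ∷ []) ⟩
      (t + y) * suc (suc q) * suc q                       ≡⟨ cong (λ u → u * suc (suc q) * suc q) h₁ ⟩
      z * suc (suc q) * suc q                             ≡⟨ cong (_* suc q) h₃ ⟩
      z' * suc (suc p + suc q) * suc q                    ≡⟨ solve (z' ∷ p ∷ q ∷ []) ⟩
      z' * suc q * suc (suc (suc p + q))                  ≡⟨ cong (_* suc (suc (suc p + q))) h₄ ⟩
      x * suc (suc p + q) * suc (suc (suc p + q))         ∎
      where open ≡-Reasoning

T-binom₂' : ∀ p q → T (suc (suc p)) q * (suc p * suc (suc p)) + paths p q * q * suc (suc p)
                    ≡ paths p q * suc (p + q) * suc (suc (p + q))
T-binom₂' p q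
  rewrite T-sym (suc (suc p)) q | paths-sym p q | +-comm p q = T-binom₂ q p

paths-corner : ∀ p q → paths (suc p) (suc q) * (suc p * suc q) ≡ paths p q * suc (p + q) * suc (suc (p + q))
paths-corner p q = begin
  paths (suc p) (suc q) * (suc p * suc q)         ≡⟨ sym (*-assoc (paths (suc p) (suc q)) (suc p) (suc q)) ⟩
  paths (suc p) (suc q) * suc p * suc q           ≡⟨ cong (_* suc q) (paths-absorbˡ p (suc q)) ⟩
  paths p (suc q) * suc (p + suc q) * suc q       ≡⟨ regroup (paths p (suc q)) ⟩
  paths p (suc q) * suc q * suc (suc (p + q))     ≡⟨ cong (_* suc (suc (p + q))) (paths-absorbʳ p q) ⟩
  paths p q * suc (p + q) * suc (suc (p + q))     ∎
  where
    open ≡-Reasoning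
    regroup : ∀ y → y * suc (p + suc q) * suc q ≡ y * suc q * suc (suc (p + q))
    regroup y = solve (y ∷ p ∷ q ∷ [])

-- The closed form with denominators cleared.  With m = a+2, n = b+2,
-- s = m+n−2, P = (m−1)(n−1), K = T_{m−1,n−1} + (n−1) T_{m−2,n} + (m−1) T_{m,n−2}
-- and Q = C(m+n−2, m−1):   K m n s + Q P m n = Q (m n s + P (m+n) s).
-- Adding X (a+b+1) m n s to both sides, the four relations expressing the
-- T's and Q through X = Q(a+b, a) turn both sides into the same polynomial.
cleared-identity : ∀ a b X Q T₁ T₃ T₅ →
  T₁ + X ≡ Q →
  T₃ * (suc b * suc (suc b)) + X * a * suc (suc b) ≡ X * suc (a + b) * suc (suc (a + b)) →
  T₅ * (suc a * suc (suc a)) + X * b * suc (suc a) ≡ X * suc (a + b) * suc (suc (a + b)) →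
  Q * (suc a * suc b) ≡ X * suc (a + b) * suc (suc (a + b)) →
  (T₁ + suc b * T₃ + suc a * T₅) * (suc (suc a) * suc (suc b) * (a + suc (suc b)))
    + Q * (suc a * suc b) * (suc (suc a) * suc (suc b))
  ≡ Q * (suc (suc a) * suc (suc b) * (a + suc (suc b))
         + (suc a * suc b) * ((suc (suc a) + suc (suc b)) * (a + suc (suc b))))
cleared-identity a b X Q T₁ T₃ T₅ h₁ h₃ h₅ hC =
  +-cancelʳ-≡ (X * suc (a + b) * (suc (suc a) * suc (suc b) * (a + suc (suc b)))) _ _ (trans lhs (sym rhs))
  where
    open ≡-Reasoning
    lhs : (T₁ + suc b * T₃ + suc a * T₅) * (suc (suc a) * suc (suc b) * (a + suc (suc b)))
            + Q * (suc a * suc b) * (suc (suc a) * suc (suc b))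
            + X * suc (a + b) * (suc (suc a) * suc (suc b) * (a + suc (suc b)))
          ≡ Q * (suc (suc a) * suc (suc b) * (a + suc (suc b)))
            + (X * suc (a + b) * suc (suc (a + b))) * ((suc (suc a) + suc (suc b)) * (a + suc (suc b)))
            + (X * suc (a + b) * suc (suc (a + b))) * (suc (suc a) * suc (suc b))
    lhs = begin
      (T₁ + suc b * T₃ + suc a * T₅) * (suc (suc a) * suc (suc b) * (a + suc (suc b)))
        + Q * (suc a * suc b) * (suc (suc a) * suc (suc b))
        + X * suc (a + b) * (suc (suc a) * suc (suc b) * (a + suc (suc b)))
        ≡⟨ solve (a ∷ b ∷ X ∷ Q ∷ T₁ ∷ T₃ ∷ T₅ ∷ []) ⟩
      (T₁ + X) * (suc (suc a) * suc (suc b) * (a + suc (suc b)))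
        + (T₃ * (suc b * suc (suc b)) + X * a * suc (suc b)) * (suc (suc a) * (a + suc (suc b)))
        + (T₅ * (suc a * suc (suc a)) + X * b * suc (suc a)) * (suc (suc b) * (a + suc (suc b)))
        + Q * (suc a * suc b) * (suc (suc a) * suc (suc b))
        ≡⟨ cong₂ _+_ (cong₂ _+_ (cong₂ _+_ (cong (_* (suc (suc a) * suc (suc b) * (a + suc (suc b)))) h₁)
                                            (cong (_* (suc (suc a) * (a + suc (suc b)))) h₃))
                                 (cong (_* (suc (suc b) * (a + suc (suc b)))) h₅))
                     (cong (_* (suc (suc a) * suc (suc b))) hC) ⟩
      Q * (suc (suc a) * suc (suc b) * (a + suc (suc b)))
        + (X * suc (a + b) * suc (suc (a + b))) * (suc (suc a) * (a + suc (suc b)))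
        + (X * suc (a + b) * suc (suc (a + b))) * (suc (suc b) * (a + suc (suc b)))
        + (X * suc (a + b) * suc (suc (a + b))) * (suc (suc a) * suc (suc b))
        ≡⟨ solve (a ∷ b ∷ X ∷ Q ∷ []) ⟩
      Q * (suc (suc a) * suc (suc b) * (a + suc (suc b)))
        + (X * suc (a + b) * suc (suc (a + b))) * ((suc (suc a) + suc (suc b)) * (a + suc (suc b)))
        + (X * suc (a + b) * suc (suc (a + b))) * (suc (suc a) * suc (suc b)) ∎
    rhs : Q * (suc (suc a) * suc (suc b) * (a + suc (suc b))
               + (suc a * suc b) * ((suc (suc a) + suc (suc b)) * (a + suc (suc b))))
            + X * suc (a + b) * (suc (suc a) * suc (suc b) * (a + suc (suc b)))
          ≡ Q * (suc (suc a) * suc (suc b) * (a + suc (suc b)))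
            + (X * suc (a + b) * suc (suc (a + b))) * ((suc (suc a) + suc (suc b)) * (a + suc (suc b)))
            + (X * suc (a + b) * suc (suc (a + b))) * (suc (suc a) * suc (suc b))
    rhs = begin
      Q * (suc (suc a) * suc (suc b) * (a + suc (suc b))
           + (suc a * suc b) * ((suc (suc a) + suc (suc b)) * (a + suc (suc b))))
        + X * suc (a + b) * (suc (suc a) * suc (suc b) * (a + suc (suc b)))
        ≡⟨ solve (a ∷ b ∷ X ∷ Q ∷ []) ⟩
      Q * (suc (suc a) * suc (suc b) * (a + suc (suc b)))
        + Q * (suc a * suc b) * ((suc (suc a) + suc (suc b)) * (a + suc (suc b)))
        + (X * suc (a + b) * suc (suc (a + b))) * (suc (suc a) * suc (suc b))
        ≡⟨ cong (λ u → Q * (suc (suc a) * suc (suc b) * (a + suc (suc b)))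
                         + u * ((suc (suc a) + suc (suc b)) * (a + suc (suc b)))
                         + (X * suc (a + b) * suc (suc (a + b))) * (suc (suc a) * suc (suc b))) hC ⟩
      Q * (suc (suc a) * suc (suc b) * (a + suc (suc b)))
        + (X * suc (a + b) * suc (suc (a + b))) * ((suc (suc a) + suc (suc b)) * (a + suc (suc b)))
        + (X * suc (a + b) * suc (suc (a + b))) * (suc (suc a) * suc (suc b)) ∎

ℚ-ring : ACR.AlmostCommutativeRing 0ℓ 0ℓ
ℚ-ring = ACR.fromCommutativeRing ℚP.+-*-commutativeRing (λ x → dec⇒maybe (0ℚ ℚP.≟ x))

ℕtoℚᵘ : ℕ → ℚᵘ
ℕtoℚᵘ k = mkℚᵘ (pos k) 0

toℚᵘ-ℕtoℚ : ∀ k → toℚᵘ (ℕtoℚ k) ≃ᵘ ℕtoℚᵘ k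
toℚᵘ-ℕtoℚ k = ℚP.toℚᵘ-fromℚᵘ (ℕtoℚᵘ k)

ℕtoℚᵘ-+ : ∀ x y → ℕtoℚᵘ (x + y) ≃ᵘ ℕtoℚᵘ x +ᵘ ℕtoℚᵘ y
ℕtoℚᵘ-+ x y = *≡* (begin
  pos (x + y) ℤ.* pos 1                                 ≡⟨ ℤP.*-identityʳ _ ⟩
  pos (x + y)                                           ≡⟨ ℤP.pos-+ x y ⟩
  pos x ℤ.+ pos y                                       ≡⟨ cong₂ ℤ._+_ (sym (ℤP.*-identityʳ (pos x))) (sym (ℤP.*-identityʳ (pos y))) ⟩
  pos x ℤ.* pos 1 ℤ.+ pos y ℤ.* pos 1                   ≡⟨ sym (ℤP.*-identityʳ _) ⟩
  (pos x ℤ.* pos 1 ℤ.+ pos y ℤ.* pos 1) ℤ.* pos 1       ∎)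
  where open ≡-Reasoning

ℕtoℚᵘ-* : ∀ x y → ℕtoℚᵘ (x * y) ≃ᵘ ℕtoℚᵘ x *ᵘ ℕtoℚᵘ y
ℕtoℚᵘ-* x y = *≡* (begin
  pos (x * y) ℤ.* pos 1        ≡⟨ ℤP.*-identityʳ _ ⟩
  pos (x * y)                  ≡⟨ ℤP.pos-* x y ⟩
  pos x ℤ.* pos y              ≡⟨ sym (ℤP.*-identityʳ _) ⟩
  (pos x ℤ.* pos y) ℤ.* pos 1  ∎)
  where open ≡-Reasoning

ℕtoℚ-+ : ∀ x y → ℕtoℚ (x + y) ≡ ℕtoℚ x +ℚ ℕtoℚ y
ℕtoℚ-+ x y = ℚP.toℚᵘ-injective (≃-trans (toℚᵘ-ℕtoℚ (x + y)) (≃-trans (ℕtoℚᵘ-+ x y)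
  (≃-sym (≃-trans (ℚP.toℚᵘ-homo-+ (ℕtoℚ x) (ℕtoℚ y)) (ℚᵘP.+-cong (toℚᵘ-ℕtoℚ x) (toℚᵘ-ℕtoℚ y))))))

ℕtoℚ-* : ∀ x y → ℕtoℚ (x * y) ≡ ℕtoℚ x *ℚ ℕtoℚ y
ℕtoℚ-* x y = ℚP.toℚᵘ-injective (≃-trans (toℚᵘ-ℕtoℚ (x * y)) (≃-trans (ℕtoℚᵘ-* x y)
  (≃-sym (≃-trans (ℚP.toℚᵘ-homo-* (ℕtoℚ x) (ℕtoℚ y)) (ℚᵘP.*-cong (toℚᵘ-ℕtoℚ x) (toℚᵘ-ℕtoℚ y))))))

recip-inverse : ∀ k (k>0 : 0 < k) → recip k k>0 *ℚ ℕtoℚ k ≡ 1ℚ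
recip-inverse (suc k) _ = ℚP.toℚᵘ-injective (≃-trans (ℚP.toℚᵘ-homo-* (recip (suc k) z<s) (ℕtoℚ (suc k)))
  (≃-trans (ℚᵘP.*-cong (ℚP.toℚᵘ-fromℚᵘ (mkℚᵘ (pos 1) k)) (toℚᵘ-ℕtoℚ (suc k))) (≃-trans inverse (≃-sym (toℚᵘ-ℕtoℚ 1)))))
  where
    open ≡-Reasoning
    inverse : mkℚᵘ (pos 1) k *ᵘ ℕtoℚᵘ (suc k) ≃ᵘ ℕtoℚᵘ 1
    inverse = *≡* (begin
      (pos 1 ℤ.* pos (suc k)) ℤ.* pos 1   ≡⟨ ℤP.*-identityʳ _ ⟩
      pos 1 ℤ.* pos (suc k)               ≡⟨ ℤP.*-identityˡ _ ⟩
      pos (suc k)                         ≡⟨ cong pos (sym (*-identityʳ (suc k))) ⟩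
      pos (suc k * 1)                     ≡⟨ sym (ℤP.*-identityˡ _) ⟩
      pos 1 ℤ.* pos (suc k * 1)           ∎)

ℕtoℚ-cleared : ∀ k c p m n s → k * (m * n * s) + c * p * (m * n) ≡ c * (m * n * s + p * ((m + n) * s)) →
  let ι = ℕtoℚ in
  ι k *ℚ (ι m *ℚ ι n *ℚ ι s) +ℚ ι c *ℚ ι p *ℚ (ι m *ℚ ι n)
    ≡ ι c *ℚ (ι m *ℚ ι n *ℚ ι s +ℚ ι p *ℚ ((ι m +ℚ ι n) *ℚ ι s))
ℕtoℚ-cleared k c p m n s eq = begin
  ι k *ℚ (ι m *ℚ ι n *ℚ ι s) +ℚ ι c *ℚ ι p *ℚ (ι m *ℚ ι n)
    ≡⟨ sym (cong₂ _+ℚ_ (trans (ι-* k (m * n * s)) (cong (ι k *ℚ_) (ι-*₃ m n s)))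
                        (trans (ι-* (c * p) (m * n)) (cong₂ _*ℚ_ (ι-* c p) (ι-* m n)))) ⟩
  ι (k * (m * n * s)) +ℚ ι (c * p * (m * n))
    ≡⟨ sym (ι-+ (k * (m * n * s)) (c * p * (m * n))) ⟩
  ι (k * (m * n * s) + c * p * (m * n))
    ≡⟨ cong ι eq ⟩
  ι (c * (m * n * s + p * ((m + n) * s)))
    ≡⟨ ι-* c (m * n * s + p * ((m + n) * s)) ⟩
  ι c *ℚ ι (m * n * s + p * ((m + n) * s))
    ≡⟨ cong (ι c *ℚ_) (trans (ι-+ (m * n * s) (p * ((m + n) * s))) (cong₂ _+ℚ_ (ι-*₃ m n s) (ι-* p ((m + n) * s)))) ⟩
  ι c *ℚ (ι m *ℚ ι n *ℚ ι s +ℚ ι p *ℚ ι ((m + n) * s))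
    ≡⟨ cong (λ z → ι c *ℚ (ι m *ℚ ι n *ℚ ι s +ℚ ι p *ℚ z)) (trans (ι-* (m + n) s) (cong (_*ℚ ι s) (ι-+ m n))) ⟩
  ι c *ℚ (ι m *ℚ ι n *ℚ ι s +ℚ ι p *ℚ ((ι m +ℚ ι n) *ℚ ι s)) ∎
  where
    open ≡-Reasoning
    ι : ℕ → ℚ
    ι = ℕtoℚ
    ι-+ : ∀ x y → ι (x + y) ≡ ι x +ℚ ι y
    ι-+ = ℕtoℚ-+
    ι-* : ∀ x y → ι (x * y) ≡ ι x *ℚ ι y
    ι-* = ℕtoℚ-*
    ι-*₃ : ∀ x y z → ι (x * y * z) ≡ ι x *ℚ ι y *ℚ ι z
    ι-*₃ x y z = trans (ι-* (x * y) z) (cong (_*ℚ ι z) (ι-* x y))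

collapse : ∀ (c p rm rn rs u v w : ℚ) → u ≡ 1ℚ → v ≡ 1ℚ → w ≡ 1ℚ →
  c *ℚ (u *ℚ v *ℚ w) +ℚ c *ℚ p *ℚ (rn *ℚ u *ℚ w +ℚ rm *ℚ v *ℚ w -ℚ rs *ℚ u *ℚ v) ≡ c *ℚ (1ℚ +ℚ p *ℚ (rm +ℚ rn -ℚ rs))
collapse c p rm rn rs _ _ _ refl refl refl = RingSolver.solve (c ∷ p ∷ rm ∷ rn ∷ rs ∷ []) ℚ-ring

divide-out : ∀ (k c p m n s rm rn rs : ℚ) → rm *ℚ m ≡ 1ℚ → rn *ℚ n ≡ 1ℚ → rs *ℚ s ≡ 1ℚ →
  k *ℚ (m *ℚ n *ℚ s) +ℚ c *ℚ p *ℚ (m *ℚ n) ≡ c *ℚ (m *ℚ n *ℚ s +ℚ p *ℚ ((m +ℚ n) *ℚ s)) →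
  k ≡ c *ℚ (1ℚ +ℚ p *ℚ (rm +ℚ rn -ℚ rs))
divide-out k c p m n s rm rn rs im in′ is e = begin
  k                                               ≡⟨ RingSolver.solve (k ∷ []) ℚ-ring ⟩
  k *ℚ (1ℚ *ℚ 1ℚ *ℚ 1ℚ)                           ≡⟨ cong (k *ℚ_) (sym (cong₂ _*ℚ_ (cong₂ _*ℚ_ im in′) is)) ⟩
  k *ℚ ((rm *ℚ m) *ℚ (rn *ℚ n) *ℚ (rs *ℚ s))      ≡⟨ RingSolver.solve (k ∷ c ∷ p ∷ m ∷ n ∷ s ∷ rm ∷ rn ∷ rs ∷ []) ℚ-ring ⟩
  (k *ℚ (m *ℚ n *ℚ s) +ℚ c *ℚ p *ℚ (m *ℚ n)) *ℚ (rm *ℚ rn *ℚ rs) -ℚ c *ℚ p *ℚ (m *ℚ n) *ℚ (rm *ℚ rn *ℚ rs)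
    ≡⟨ cong (λ x → x *ℚ (rm *ℚ rn *ℚ rs) -ℚ c *ℚ p *ℚ (m *ℚ n) *ℚ (rm *ℚ rn *ℚ rs)) e ⟩
  c *ℚ (m *ℚ n *ℚ s +ℚ p *ℚ ((m +ℚ n) *ℚ s)) *ℚ (rm *ℚ rn *ℚ rs) -ℚ c *ℚ p *ℚ (m *ℚ n) *ℚ (rm *ℚ rn *ℚ rs)
    ≡⟨ RingSolver.solve (k ∷ c ∷ p ∷ m ∷ n ∷ s ∷ rm ∷ rn ∷ rs ∷ []) ℚ-ring ⟩
  c *ℚ ((rm *ℚ m) *ℚ (rn *ℚ n) *ℚ (rs *ℚ s))
    +ℚ c *ℚ p *ℚ (rn *ℚ (rm *ℚ m) *ℚ (rs *ℚ s) +ℚ rm *ℚ (rn *ℚ n) *ℚ (rs *ℚ s) -ℚ rs *ℚ (rm *ℚ m) *ℚ (rn *ℚ n))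
    ≡⟨ collapse c p rm rn rs (rm *ℚ m) (rn *ℚ n) (rs *ℚ s) im in′ is ⟩
  c *ℚ (1ℚ +ℚ p *ℚ (rm +ℚ rn -ℚ rs)) ∎
  where open ≡-Reasoning

closed-form : ∀ a b (hm : 2 ≤ suc (suc a)) (hn : 2 ≤ suc (suc b)) →
  ℕtoℚ (T (suc a) (suc b) + suc b * T a (suc (suc b)) + suc a * T (suc (suc a)) b) ≡ closedForm (suc (suc a)) (suc (suc b)) hm hn
closed-form a b hm hn = begin
  ℕtoℚ (T (suc a) (suc b) + suc b * T a (suc (suc b)) + suc a * T (suc (suc a)) b)
    ≡⟨ divide-out (ℕtoℚ K) (ℕtoℚ Q) (ℕtoℚ P) (ℕtoℚ m) (ℕtoℚ n) (ℕtoℚ s) rm rn rs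
         (recip-inverse m z<s) (recip-inverse n z<s) (recip-inverse s s>0)
         (ℕtoℚ-cleared K Q P m n s
            (cleared-identity a b (paths a b) Q (T (suc a) (suc b)) (T a (suc (suc b))) (T (suc (suc a)) b)
               (T-binom a b) (T-binom₂ a b) (T-binom₂' a b) (paths-corner a b))) ⟩
  ℕtoℚ (paths (suc a) (suc b)) *ℚ (1ℚ +ℚ ℕtoℚ (suc a * suc b) *ℚ (rm +ℚ rn -ℚ rs))
    ≡⟨ cong (λ c → ℕtoℚ c *ℚ (1ℚ +ℚ ℕtoℚ (suc a * suc b) *ℚ (rm +ℚ rn -ℚ rs)))
            (trans (paths-binomial (suc a) (suc b)) (cong (_C suc a) (sym (+-suc a (suc b))))) ⟩
  closedForm (suc (suc a)) (suc (suc b)) hm hn ∎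
  where
    open ≡-Reasoning
    K Q P m n s : ℕ
    K = T (suc a) (suc b) + suc b * T a (suc (suc b)) + suc a * T (suc (suc a)) b
    Q = paths (suc a) (suc b)
    P = suc a * suc b
    m = suc (suc a)
    n = suc (suc b)
    s = a + suc (suc b)
    s>0 : 0 < s
    s>0 = subst (0 <_) (sym (+-suc a (suc b))) z<s
    rm rn rs : ℚ
    rm = recip m z<s
    rn = recip n z<s
    rs = recip s s>0

-- Each hypothesis pins tᵢ to the box count T; the three claims are then the
-- count of the punctured rectangle, T_{1,n-1} = n−1 and T_{m-1,1} = m−1, and
-- the closed form.
proposition4p2 : ∀ (m n : ℕ) (hm : 2 ≤ m) (hn : 2 ≤ n)
    {t₁ t₂ t₃ t₄ t₅ : ℕ} →
    TCount (m ∸ 1) (n ∸ 1) t₁ →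
    TCount 1 (n ∸ 1) t₂ →
    TCount (m ∸ 2) n t₃ →
    TCount (m ∸ 1) 1 t₄ →
    TCount m (n ∸ 2) t₅ →
    NumTilings (RectNW m n) (t₁ + t₂ * t₃ + t₄ * t₅)
    × (t₁ + t₂ * t₃ + t₄ * t₅ ≡ t₁ + (n ∸ 1) * t₃ + (m ∸ 1) * t₅)
    × (ℕtoℚ (t₁ + (n ∸ 1) * t₃ + (m ∸ 1) * t₅) ≡ closedForm m n hm hn)
proposition4p2 (suc (suc a)) (suc (suc b)) hm@(s≤s (s≤s _)) hn@(s≤s (s≤s _)) c₁ c₂ c₃ c₄ c₅
  rewrite TCount⇒T _ _ _ c₁ | TCount⇒T _ _ _ c₂ | TCount⇒T _ _ _ c₃ | TCount⇒T _ _ _ c₄ | TCount⇒T _ _ _ c₅ =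
    Punctured.punctured-count a b ,
    cong₂ (λ u v → T (suc a) (suc b) + u * T a (suc (suc b)) + v * T (suc (suc a)) b) (T-row b) (T-col a) ,
    closed-form a b hm hn
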